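{- Let $C$ be a linear $[n,k]$ code over the finite field $\mathbb{F}_q$ and let $f\in\mathrm{Harm}_d$ be a harmonic function of degree $d$. Then \[ Z_{C,f}(x,y)=(-1)^{d}(x-y)^{k-d}\,y^{n-k-d}\;T\!\left(M_C,f;\frac{x+(q-1)y}{x-y},\frac{x}{y}\right). \]
   Context: $E=\{1,\dots,n\}$ and $E_d$ is the set of $d$-element subsets of $E$. For $f:E_d\to\mathbb{R}$, $\widetilde f(X):=\sum_{Z\in E_d,\,Z\subset X}f(Z)$ for $X\subset E$. $\mathrm{Harm}_d$ is the set of $f:E_d\to\mathbb{R}$ with $\sum_{Z\in E_d,\,Z\supset Y}f(Z)=0$ for every $(d-1)$-subset $Y\subset E$. For $\mathbf u\in\mathbb{F}_q^n$, $\mathrm{supp}(\mathbf u)=\{i:u_i\ne0\}$, $\mathrm{wt}(\mathbf u)=|\mathrm{supp}(\mathbf u)|$, $\widetilde f(\mathbf u):=\widetilde f(\mathrm{supp}(\mathbf u))$. With $A_{i,f}:=\sum_{\mathbf u\in C,\,\mathrm{wt}(\mathbf u)=i}\widetilde f(\mathbf u)$, the harmonic weight enumerator is $W_{C,f}(x,y)=\sum_iA_{i,f}x^{n-i}y^i$ and $Z_{C,f}(x,y):=\sum_{i=0}^nA_{i,f}x^{n-i-d}y^{i-d}$ (so $W_{C,f}=(xy)^dZ_{C,f}$). $M_C$ is the matroid on $E$ whose independent sets are the index sets of linearly independent columns (over $\mathbb{F}_q$) of a generator matrix of $C$, with rank function $\rho$. The harmonic Tutte polynomial is $T(M,f;x,y):=\sum_{J\subset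 E}\widetilde f(J)(x-1)^{\rho(E)-\rho(J)}(y-1)^{|J|-\rho(J)}$. -}

module Defs where

open import Level using (Level; _⊔_) renaming (suc to lsuc)
open import Algebra.Bundles using (CommutativeRing)
open import Data.Nat as ℕ using (ℕ; zero; suc; _≤_; _∸_)
open import Data.Integer as ℤ using (ℤ; +_; -[1+_])
open import Data.Fin using (Fin)
open import Data.Fin.Subset using (Subset; inside; outside; ∣_∣; _⊆_; _∈_)
open import Data.Fin.Subset.Properties using (_⊆?_; _∈?_)
open import Data.List using (List; []; _∷_; [_]; _++_; map; foldr; filter; concatMap; length; allFin; upTo)
open import Data.List.Relation.Unary.Any using (Any)
open import Data.Vec using (Vec; []; _∷_; lookup; tabulate)
import Data.List.Relation.Unary.Unique.Setoid as UniqueS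
open import Data.Product using (∃; _×_; _,_)
open import Data.Bool using (if_then_else_)
open import Relation.Nullary using (¬_; does)
open import Relation.Binary using (Decidable)
open import Relation.Binary.PropositionalEquality using (_≡_)
open import Data.Nat.Properties using () renaming (_≟_ to _≟ℕ_)

record Field c ℓ : Set (lsuc (c ⊔ ℓ)) where
  field
    commutativeRing : CommutativeRing c ℓ
  open CommutativeRing commutativeRing public
  field
    0≉1     : ¬ (0# ≈ 1#)
    inv     : (x : Carrier) → ¬ (x ≈ 0#) → Carrier
    inv-law : ∀ x (h : ¬ (x ≈ 0#)) → (x * inv x h) ≈ 1#

  _−_ : Carrier → Carrier → Carrier
  x − y = x + (- y)

  ℕ→ : ℕ → Carrier
  ℕ→ zero    = 0#
  ℕ→ (suc m) = 1# + ℕ→ m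

  pow : Carrier → ℕ → Carrier
  pow x zero    = 1#
  pow x (suc m) = x * pow x m

  powℤ : (x : Carrier) → ¬ (x ≈ 0#) → ℤ → Carrier
  powℤ x h (+ m)      = pow x m
  powℤ x h -[1+ m ]   = pow (inv x h) (suc m)

  sumOver : ∀ {a} {A : Set a} → List A → (A → Carrier) → Carrier
  sumOver xs g = foldr (λ a r → g a + r) 0# xs

CharZero : ∀ {c ℓ} → Field c ℓ → Set ℓ
CharZero K = ∀ m → ¬ (ℕ→ (suc m) ≈ 0#)
  where open Field K

record FiniteField c ℓ : Set (lsuc (c ⊔ ℓ)) where
  field
    field′ : Field c ℓ
  open Field field′ public
  field
    _≟_      : Decidable _≈_
    elements : List Carrier
    elements-unique   : UniqueS.Unique setoid elements
    elements-complete : ∀ x → Any (x ≈_) elements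

  q : ℕ
  q = length elements

allSubsets : ∀ n → List (Subset n)
allSubsets zero    = [ [] ]
allSubsets (suc n) = map (outside ∷_) (allSubsets n) ++ map (inside ∷_) (allSubsets n)

vecs : ∀ {a} {A : Set a} → List A → ∀ k → List (Vec A k)
vecs xs zero    = [ [] ]
vecs xs (suc k) = concatMap (λ a → map (a ∷_) (vecs xs k)) xs

subsetsOfSize : ∀ n → ℕ → List (Subset n)
subsetsOfSize n d = filter (λ Z → ∣ Z ∣ ≟ℕ d) (allSubsets n)

module Code {c ℓ} (F : FiniteField c ℓ) where
  open FiniteField F

  Matrix : ℕ → ℕ → Set c
  Matrix k n = Fin k → Fin n → Carrier

  -- the rows of G are linearly independent (so C = row space of G is an [n,k] code)
  RowsIndependent : ∀ {k n} → Matrix k n → Set (c ⊔ ℓ)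
  RowsIndependent {k} {n} G =
    ∀ (m : Fin k → Carrier) →
      (∀ j → sumOver (allFin k) (λ i → m i * G i j) ≈ 0#) → ∀ i → m i ≈ 0#

  ColumnsIndependent : ∀ {k n} → Matrix k n → Subset n → Set (c ⊔ ℓ)
  ColumnsIndependent {k} {n} G S =
    ∀ (a : Fin n → Carrier) →
      (∀ i → sumOver (filter (_∈? S) (allFin n)) (λ j → a j * G i j) ≈ 0#) →
      ∀ j → j ∈ S → a j ≈ 0#

  IsRankFunction : ∀ {k n} → Matrix k n → (Subset n → ℕ) → Set (c ⊔ ℓ)
  IsRankFunction {k} {n} G ρ =
    ∀ (J : Subset n) →
      (∃ λ I → I ⊆ J × ColumnsIndependent G I × ∣ I ∣ ≡ ρ J) ×
      (∀ I → I ⊆ J → ColumnsIndependent G I → ∣ I ∣ ≤ ρ J)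

  encode : ∀ {k n} → Matrix k n → Vec Carrier k → Fin n → Carrier
  encode {k} G m j = sumOver (allFin k) (λ i → lookup m i * G i j)

  -- the list of all codewords of C (each once, when the rows are independent)
  codewords : ∀ {k n} → Matrix k n → List (Fin n → Carrier)
  codewords {k} G = map (encode G) (vecs elements k)

  supp : ∀ {n} → (Fin n → Carrier) → Subset n
  supp u = tabulate (λ j → if does (u j ≟ 0#) then outside else inside)

  wt : ∀ {n} → (Fin n → Carrier) → ℕ
  wt u = ∣ supp u ∣

-- Harmonic functions, harmonic weight enumerator, harmonic Tutte polynomial.
-- f : E_d → K is represented by a function on all subsets; only its
-- values on d-subsets are ever used.

module Harmonic {c ℓ} (K : Field c ℓ) where
  open Field K

  tilde : ∀ {n} → ℕ → (Subset n → Carrier) → Subset n → Carrier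
  tilde {n} d f X = sumOver (filter (_⊆? X) (subsetsOfSize n d)) f

  IsHarmonic : ∀ {n} → ℕ → (Subset n → Carrier) → Set ℓ
  IsHarmonic {n} d f =
    ∀ (Y : Subset n) → suc ∣ Y ∣ ≡ d →
      sumOver (filter (Y ⊆?_) (subsetsOfSize n d)) f ≈ 0#

  tutte : ∀ {n} → (Subset n → ℕ) → ℕ → (Subset n → Carrier) →
          Carrier → Carrier → Carrier
  tutte {n} ρ d f X Y =
    sumOver (allSubsets n) (λ J →
      tilde d f J * pow (X − 1#) (ρ (tabulate (λ _ → inside)) ∸ ρ J)
                  * pow (Y − 1#) (∣ J ∣ ∸ ρ J))

  module _ {c′ ℓ′} (F : FiniteField c′ ℓ′) where
    open Code F using (Matrix; codewords; supp; wt)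

    A : ∀ {k n} → Matrix k n → ℕ → (Subset n → Carrier) → ℕ → Carrier
    A G d f i = sumOver (filter (λ u → wt u ≟ℕ i) (codewords G)) (λ u → tilde d f (supp u))

    Zpoly : ∀ {k n} → Matrix k n → ℕ → (Subset n → Carrier) →
            (x y : Carrier) → ¬ (x ≈ 0#) → ¬ (y ≈ 0#) → Carrier
    Zpoly {k} {n} G d f x y hx hy =
      sumOver (upTo (suc n)) (λ i →
        A G d f i * powℤ x hx ((+ n) ℤ.- (+ i) ℤ.- (+ d))
                  * powℤ y hy ((+ i) ℤ.- (+ d)))

-- Write Z_{C,f} as a sum over the codewords u. For harmonic f in characteristic 0 the complement
-- identity f~(S) = (-1)^d f~(E - S) holds: the sums a_j of f over the d-sets meeting S in j points
-- satisfy (j + 1) a_{j+1} + (d - j) a_j = 0, which is harmonicity summed over the (d-1)-sets.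
-- It turns the term of u into one indexed by the zero set T of u, and expanding x = (x - y) + y
-- binomially over the subsets J of T gives the sum of f~(J) (x - y)^(|J| - d) y^(n - |J| - d).
-- Exchanging the sums, J is counted once for each codeword vanishing on J, and there are
-- q^(k - ρ(J)) of them. What remains is the Tutte sum at X - 1 = q y / (x - y), Y - 1 = (x - y) / y.

module Submission where

open import Defs
open import Level using (Lift; lift; _⊔_)
open import Algebra.Bundles using (CommutativeSemiring)
import Algebra.Properties.CommutativeSemigroup as CommutativeSemigroupProperties
import Algebra.Properties.Ring as RingProperties
open import Data.Bool using (Bool; true; false; if_then_else_; _∧_; T)
open import Data.Bool.Properties using (∧-zeroʳ)
open import Data.Integer as ℤ using (+_; _-_)
import Data.Integer.Properties as ℤ
import Data.Integer.Tactic.RingSolver as ℤ-Solver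
import Data.Nat.Tactic.RingSolver as ℕ-Solver
open import Data.List using (List; []; _∷_; _++_; map; foldr; filter; concatMap; allFin)
import Data.List.Properties as List
open import Data.List.Membership.Propositional using () renaming (_∈_ to _∈ₗ_)
open import Data.List.Relation.Unary.Any using (here; there)
open import Data.Nat as ℕ using (ℕ; zero; suc; _≤_; _∸_; _!)
import Data.Nat.Properties as ℕ
open import Data.Fin as Fin using (Fin)
open import Data.Vec using (Vec; []; _∷_)
open import Data.Fin.Subset using (Subset)
open import Data.Sum using (inj₁; inj₂; [_,_]′)
open import Function using (_∘_; id)
open import Relation.Nullary using (¬_; Dec; does)
open import Relation.Binary.PropositionalEquality as ≡ using (_≡_)

module Sums {c ℓ} (S : CommutativeSemiring c ℓ) where
  open CommutativeSemiring S
  open import Data.List.Relation.Unary.All.Properties using (All¬⇒¬Any)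
  open import Data.List.Relation.Unary.AllPairs using (_∷_)
  open import Data.List.Relation.Unary.Unique.Propositional using (Unique)
  open import Relation.Nullary.Decidable using (dec-true; dec-false)
  open import Relation.Binary.Reasoning.Setoid setoid

  Σ : ∀ {a} {A : Set a} → List A → (A → Carrier) → Carrier
  Σ xs g = foldr (λ a r → g a + r) 0# xs

  when : Bool → Carrier → Carrier
  when b x = if b then x else 0#

  module _ {a} {A : Set a} where

    Σ-cong : ∀ (xs : List A) {g h : A → Carrier} → (∀ x → g x ≈ h x) → Σ xs g ≈ Σ xs h
    Σ-cong []       g≈h = refl
    Σ-cong (x ∷ xs) g≈h = +-cong (g≈h x) (Σ-cong xs g≈h)

    Σ-cong-∈ : ∀ (xs : List A) {g h : A → Carrier} → (∀ x → x ∈ₗ xs → g x ≈ h x) → Σ xs g ≈ Σ xs h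
    Σ-cong-∈ []       g≈h = refl
    Σ-cong-∈ (x ∷ xs) g≈h = +-cong (g≈h x (here ≡.refl)) (Σ-cong-∈ xs (λ y y∈ → g≈h y (there y∈)))

    Σ-zero : ∀ (xs : List A) → Σ xs (λ _ → 0#) ≈ 0#
    Σ-zero []       = refl
    Σ-zero (x ∷ xs) = trans (+-identityˡ _) (Σ-zero xs)

    Σ-++ : ∀ (xs ys : List A) (g : A → Carrier) → Σ (xs ++ ys) g ≈ Σ xs g + Σ ys g
    Σ-++ []       ys g = sym (+-identityˡ _)
    Σ-++ (x ∷ xs) ys g = trans (+-cong refl (Σ-++ xs ys g)) (sym (+-assoc _ _ _))

    Σ-+ : ∀ (xs : List A) (g h : A → Carrier) → Σ xs (λ x → g x + h x) ≈ Σ xs g + Σ xs h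
    Σ-+ []       g h = sym (+-identityˡ _)
    Σ-+ (x ∷ xs) g h = begin
      (g x + h x) + Σ xs (λ x → g x + h x) ≈⟨ +-cong refl (Σ-+ xs g h) ⟩
      (g x + h x) + (Σ xs g + Σ xs h)      ≈⟨ +-interchange _ _ _ _ ⟩
      (g x + Σ xs g) + (h x + Σ xs h)      ∎
      where open CommutativeSemigroupProperties +-commutativeSemigroup renaming (interchange to +-interchange)

    *-distribˡ-Σ : ∀ (xs : List A) u (g : A → Carrier) → u * Σ xs g ≈ Σ xs (λ x → u * g x)
    *-distribˡ-Σ []       u g = zeroʳ u
    *-distribˡ-Σ (x ∷ xs) u g = trans (distribˡ u _ _) (+-cong refl (*-distribˡ-Σ xs u g))

    *-distribʳ-Σ : ∀ (xs : List A) u (g : A → Carrier) → Σ xs g * u ≈ Σ xs (λ x → g x * u)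
    *-distribʳ-Σ []       u g = zeroˡ u
    *-distribʳ-Σ (x ∷ xs) u g = trans (distribʳ u _ _) (+-cong refl (*-distribʳ-Σ xs u g))

    Σ-filter : ∀ {p} {P : A → Set p} (P? : ∀ x → Dec (P x)) (xs : List A) (g : A → Carrier) →
               Σ (filter P? xs) g ≈ Σ xs (λ x → when (does (P? x)) (g x))
    Σ-filter P? []       g = refl
    Σ-filter P? (x ∷ xs) g with does (P? x)
    ... | true  = +-cong refl (Σ-filter P? xs g)
    ... | false = trans (Σ-filter P? xs g) (sym (+-identityˡ _))

  module _ {a b} {A : Set a} {B : Set b} where

    Σ-map : ∀ (f : A → B) (xs : List A) (g : B → Carrier) → Σ (map f xs) g ≈ Σ xs (g ∘ f)
    Σ-map f []       g = refl
    Σ-map f (x ∷ xs) g = +-cong refl (Σ-map f xs g)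

    Σ-concatMap : ∀ (f : A → List B) (xs : List A) (g : B → Carrier) →
                  Σ (concatMap f xs) g ≈ Σ xs (λ x → Σ (f x) g)
    Σ-concatMap f []       g = refl
    Σ-concatMap f (x ∷ xs) g = trans (Σ-++ (f x) (concatMap f xs) g) (+-cong refl (Σ-concatMap f xs g))

    Σ-swap : ∀ (xs : List A) (ys : List B) (g : A → B → Carrier) →
             Σ xs (λ x → Σ ys (g x)) ≈ Σ ys (λ y → Σ xs (λ x → g x y))
    Σ-swap []       ys g = sym (Σ-zero ys)
    Σ-swap (x ∷ xs) ys g = trans (+-cong refl (Σ-swap xs ys g)) (sym (Σ-+ ys (g x) _))

  Σ-allFin-suc : ∀ {m} (g : Fin (suc m) → Carrier) → Σ (allFin (suc m)) g ≈ g Fin.zero + Σ (allFin m) (g ∘ Fin.suc)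
  Σ-allFin-suc {m} g = +-cong refl (trans (reflexive (≡.cong (λ l → Σ l g) (≡.sym (List.map-tabulate id Fin.suc))))
                                          (Σ-map Fin.suc (allFin m) g))

  Σ-unique-point : ∀ (xs : List ℕ) w (g : ℕ → Carrier) → w ∈ₗ xs → Unique xs → Σ xs (λ i → when (w ℕ.≡ᵇ i) (g i)) ≈ g w
  Σ-unique-point (_ ∷ xs) w g (here ≡.refl) (w∉xs ∷ _) =
    trans (+-cong (reflexive (≡.cong (λ b → when b (g w)) (dec-true (w ℕ.≟ w) ≡.refl)))
                  (trans (Σ-cong-∈ xs (λ i i∈xs → reflexive (≡.cong (λ b → when b (g i))
                                         (dec-false (w ℕ.≟ i) (λ { ≡.refl → All¬⇒¬Any w∉xs i∈xs })))))
                         (Σ-zero xs)))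
          (+-identityʳ _)
  Σ-unique-point (i ∷ xs) w g (there w∈xs) (i∉xs ∷ unique) =
    trans (+-cong (reflexive (≡.cong (λ b → when b (g i)) (dec-false (w ℕ.≟ i) (λ { ≡.refl → All¬⇒¬Any i∉xs w∈xs }))))
                  (Σ-unique-point xs w g w∈xs unique))
          (+-identityˡ _)

  when-cong : ∀ b {x y} → (T b → x ≈ y) → when b x ≈ when b y
  when-cong true  x≈y = x≈y _
  when-cong false x≈y = refl

  when-false : ∀ {b} x → b ≡ false → when b x ≈ 0#
  when-false x ≡.refl = refl

  when-zero : ∀ b → when b 0# ≈ 0#
  when-zero true  = refl
  when-zero false = refl

  when-*ˡ : ∀ b x y → y * when b x ≈ when b (y * x)
  when-*ˡ true  x y = refl
  when-*ˡ false x y = zeroʳ y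

  when-*ʳ : ∀ b x y → when b x * y ≈ when b (x * y)
  when-*ʳ true  x y = refl
  when-*ʳ false x y = zeroˡ y

  when-Σ : ∀ {a} {A : Set a} b (xs : List A) (g : A → Carrier) → when b (Σ xs g) ≈ Σ xs (λ x → when b (g x))
  when-Σ true  xs g = refl
  when-Σ false xs g = sym (Σ-zero xs)

count : ∀ {a} {A : Set a} → (A → Bool) → List A → ℕ
count p xs = Σ xs (λ x → when (p x) 1)
  where open Sums ℕ.+-*-commutativeSemiring

module FieldProperties {c ℓ} (K : Field c ℓ) where
  open Field K
  open Sums commutativeSemiring public
  open import Relation.Binary.Reasoning.Setoid setoid
  open RingProperties ring public using (-1*x≈-x; -‿distribˡ-*; -‿distribʳ-*; -‿involutive; -0#≈0#; -‿+-comm; +-inverseˡ-unique)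
  open CommutativeSemigroupProperties *-commutativeSemigroup public
    using () renaming (interchange to *-interchange; x∙yz≈y∙xz to *-left-comm)
  open CommutativeSemigroupProperties +-commutativeSemigroup public
    using () renaming (interchange to +-interchange)
  open import Algebra.Solver.CommutativeMonoid *-commutativeMonoid public using (solve; _⊜_) renaming (_⊕_ to _⊗_)

  ℕ→-+ : ∀ a b → ℕ→ (a ℕ.+ b) ≈ ℕ→ a + ℕ→ b
  ℕ→-+ zero    b = sym (+-identityˡ _)
  ℕ→-+ (suc a) b = trans (+-cong refl (ℕ→-+ a b)) (sym (+-assoc _ _ _))

  ℕ→-* : ∀ a b → ℕ→ (a ℕ.* b) ≈ ℕ→ a * ℕ→ b
  ℕ→-* zero    b = sym (zeroˡ _)
  ℕ→-* (suc a) b = begin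
    ℕ→ (b ℕ.+ a ℕ.* b)       ≈⟨ ℕ→-+ b (a ℕ.* b) ⟩
    ℕ→ b + ℕ→ (a ℕ.* b)      ≈⟨ +-cong (sym (*-identityˡ _)) (ℕ→-* a b) ⟩
    1# * ℕ→ b + ℕ→ a * ℕ→ b  ≈⟨ sym (distribʳ _ _ _) ⟩
    (1# + ℕ→ a) * ℕ→ b       ∎

  pow-cong : ∀ {x y} a → x ≈ y → pow x a ≈ pow y a
  pow-cong zero    x≈y = refl
  pow-cong (suc a) x≈y = *-cong x≈y (pow-cong a x≈y)

  pow-+ : ∀ x a b → pow x (a ℕ.+ b) ≈ pow x a * pow x b
  pow-+ x zero    b = sym (*-identityˡ _)
  pow-+ x (suc a) b = trans (*-cong refl (pow-+ x a b)) (sym (*-assoc _ _ _))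

  pow-* : ∀ x y a → pow (x * y) a ≈ pow x a * pow y a
  pow-* x y zero    = sym (*-identityˡ _)
  pow-* x y (suc a) = trans (*-cong refl (pow-* x y a)) (*-interchange x y (pow x a) (pow y a))

  pow-1# : ∀ a → pow 1# a ≈ 1#
  pow-1# zero    = refl
  pow-1# (suc a) = trans (*-identityˡ _) (pow-1# a)

  ℕ→-^ : ∀ a e → ℕ→ (a ℕ.^ e) ≈ pow (ℕ→ a) e
  ℕ→-^ a zero    = +-identityʳ _
  ℕ→-^ a (suc e) = trans (ℕ→-* a (a ℕ.^ e)) (*-cong refl (ℕ→-^ a e))

  Σ-when≈count : ∀ {a} {A : Set a} (xs : List A) (p : A → Bool) X → Σ xs (λ u → when (p u) X) ≈ ℕ→ (count p xs) * X
  Σ-when≈count []       p X = sym (zeroˡ X)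
  Σ-when≈count (u ∷ xs) p X with p u
  ... | true  = trans (+-cong (sym (*-identityˡ X)) (Σ-when≈count xs p X)) (sym (distribʳ X 1# _))
  ... | false = trans (+-identityˡ _) (Σ-when≈count xs p X)

  *-cancelˡ : ∀ {x y z} → ¬ (x ≈ 0#) → x * y ≈ x * z → y ≈ z
  *-cancelˡ {x} {y} {z} x≉0 xy≈xz = begin
    y                  ≈⟨ sym (*-identityˡ y) ⟩
    1# * y             ≈⟨ *-cong (sym (inv-lawˡ x x≉0)) refl ⟩
    (inv x _ * x) * y  ≈⟨ *-assoc _ _ _ ⟩
    inv x _ * (x * y)  ≈⟨ *-cong refl xy≈xz ⟩
    inv x _ * (x * z)  ≈⟨ sym (*-assoc _ _ _) ⟩
    (inv x _ * x) * z  ≈⟨ *-cong (inv-lawˡ x x≉0) refl ⟩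
    1# * z             ≈⟨ *-identityˡ z ⟩
    z                  ∎
    where
    inv-lawˡ : ∀ x (x≉0 : ¬ (x ≈ 0#)) → inv x x≉0 * x ≈ 1#
    inv-lawˡ x x≉0 = trans (*-comm _ _) (inv-law x x≉0)

  x≉0∧x*y≈0⇒y≈0 : ∀ {x y} → ¬ (x ≈ 0#) → x * y ≈ 0# → y ≈ 0#
  x≉0∧x*y≈0⇒y≈0 x≉0 xy≈0 = *-cancelˡ x≉0 (trans xy≈0 (sym (zeroʳ _)))

  -- monomial p q = x ^ (p - q), with the exponent kept as a pair of naturals so that its arithmetic stays in ℕ.
  module Laurent (x : Carrier) (x≉0 : ¬ (x ≈ 0#)) where
    private
      x⁻¹ : Carrier
      x⁻¹ = inv x x≉0

    monomial : ℕ → ℕ → Carrier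
    monomial p q = pow x p * pow x⁻¹ q

    pow-x*pow-x⁻¹ : ∀ p → pow x p * pow x⁻¹ p ≈ 1#
    pow-x*pow-x⁻¹ p = trans (sym (pow-* x x⁻¹ p)) (trans (pow-cong p (inv-law x x≉0)) (pow-1# p))

    monomial-* : ∀ p q p′ q′ → monomial p q * monomial p′ q′ ≈ monomial (p ℕ.+ p′) (q ℕ.+ q′)
    monomial-* p q p′ q′ = trans (*-interchange _ _ _ _) (sym (*-cong (pow-+ x p p′) (pow-+ x⁻¹ q q′)))

    monomial-cancel : ∀ p q s → monomial (p ℕ.+ s) (q ℕ.+ s) ≈ monomial p q
    monomial-cancel p q s = begin
      monomial (p ℕ.+ s) (q ℕ.+ s)                      ≈⟨ sym (monomial-* p q s s) ⟩
      monomial p q * (pow x s * pow x⁻¹ s)              ≈⟨ *-cong refl (pow-x*pow-x⁻¹ s) ⟩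
      monomial p q * 1#                                 ≈⟨ *-identityʳ _ ⟩
      monomial p q                                      ∎

    monomial-≡ : ∀ p q p′ q′ → p ℕ.+ q′ ≡ p′ ℕ.+ q → monomial p q ≈ monomial p′ q′
    monomial-≡ p q p′ q′ eq = begin
      monomial p q                          ≈⟨ sym (monomial-cancel p q q′) ⟩
      monomial (p ℕ.+ q′) (q ℕ.+ q′)        ≡⟨ ≡.cong₂ monomial eq (ℕ.+-comm q q′) ⟩
      monomial (p′ ℕ.+ q) (q′ ℕ.+ q)        ≈⟨ monomial-cancel p′ q′ q ⟩
      monomial p′ q′                        ∎

    pow≈monomial : ∀ p → pow x p ≈ monomial p 0
    pow≈monomial p = sym (*-identityʳ _)

    pow-x⁻¹≈monomial : ∀ q → pow x⁻¹ q ≈ monomial 0 q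
    pow-x⁻¹≈monomial q = sym (*-identityˡ _)

    powℤ≈monomial : ∀ p q → powℤ x x≉0 (+ p ℤ.- + q) ≈ monomial p q
    powℤ≈monomial p q with ℕ.≤-<-connex q p
    ... | inj₁ q≤p rewrite ℤ.m-n≡m⊖n p q | ℤ.⊖-≥ q≤p =
      trans (pow≈monomial (p ∸ q)) (monomial-≡ (p ∸ q) 0 p q (≡.trans (ℕ.m∸n+n≡m q≤p) (≡.sym (ℕ.+-identityʳ p))))
    ... | inj₂ p<q rewrite ℤ.m-n≡m⊖n p q | ℤ.⊖-< p<q with q ∸ p in q∸p≡
    ...   | zero  with () ← ℕ.<⇒≢ (ℕ.m<n⇒0<n∸m p<q) (≡.sym q∸p≡)
    ...   | suc m = trans (pow-x⁻¹≈monomial (suc m))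
                          (monomial-≡ 0 (suc m) p q (≡.sym (≡.trans (≡.cong (p ℕ.+_) (≡.sym q∸p≡)) (ℕ.m+[n∸m]≡n (ℕ.<⇒≤ p<q)))))

    powℤ≈monomial₃ : ∀ p q r → powℤ x x≉0 (+ p ℤ.- + q ℤ.- + r) ≈ monomial p (q ℕ.+ r)
    powℤ≈monomial₃ p q r = trans (reflexive (≡.cong (powℤ x x≉0) (assoc (+ p) (+ q) (+ r)))) (powℤ≈monomial p (q ℕ.+ r))
      where
      assoc : ∀ a b c → a ℤ.- b ℤ.- c ≡ a ℤ.- (b ℤ.+ c)
      assoc = ℤ-Solver.solve-∀

module SubsetProperties where
  open import Data.Fin.Subset using (inside; outside; ∣_∣; _∩_; ∁)
  open import Data.Fin.Subset.Properties using (_⊆?_; _∈?_; ∣p∩q∣≤∣p∣; p⊆q⇒∣p∣≤∣q∣)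
  open import Data.List using (length)
  open import Relation.Nullary using (yes)

  _⊆ᵇ_ : ∀ {n} → Subset n → Subset n → Bool
  p ⊆ᵇ q = does (p ⊆? q)

  ≡ᵇ-true⇒≡ : ∀ m n → (m ℕ.≡ᵇ n) ≡ true → m ≡ n
  ≡ᵇ-true⇒≡ m n eq = ℕ.≡ᵇ⇒≡ m n (≡.subst T (≡.sym eq) _)

  <⇒≡ᵇ-false : ∀ {m n} → m ℕ.< n → (m ℕ.≡ᵇ n) ≡ false
  <⇒≡ᵇ-false {zero}  {suc n} _             = ≡.refl
  <⇒≡ᵇ-false {suc m} {suc n} (ℕ.s≤s m<n) = <⇒≡ᵇ-false m<n

  ⊆ᵇ⇒∣∣≤ : ∀ {n} (p q : Subset n) → p ⊆ᵇ q ≡ true → ∣ p ∣ ≤ ∣ q ∣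
  ⊆ᵇ⇒∣∣≤ p q eq with p ⊆? q
  ... | yes p⊆q = p⊆q⇒∣p∣≤∣q∣ p⊆q

  ∣p∩q∣≡ᵇ∣p∣ : ∀ {n} (p q : Subset n) → (∣ p ∩ q ∣ ℕ.≡ᵇ ∣ p ∣) ≡ p ⊆ᵇ q
  ∣p∩q∣≡ᵇ∣p∣ []            []            = ≡.refl
  ∣p∩q∣≡ᵇ∣p∣ (outside ∷ p) (_ ∷ q)       = ∣p∩q∣≡ᵇ∣p∣ p q
  ∣p∩q∣≡ᵇ∣p∣ (inside ∷ p)  (inside ∷ q)  = ∣p∩q∣≡ᵇ∣p∣ p q
  ∣p∩q∣≡ᵇ∣p∣ (inside ∷ p)  (outside ∷ q) = <⇒≡ᵇ-false (ℕ.s≤s (∣p∩q∣≤∣p∣ p q))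

  ∣p∩q∣≡ᵇ0 : ∀ {n} (p q : Subset n) → (∣ p ∩ q ∣ ℕ.≡ᵇ 0) ≡ p ⊆ᵇ ∁ q
  ∣p∩q∣≡ᵇ0 []            []            = ≡.refl
  ∣p∩q∣≡ᵇ0 (outside ∷ p) (_ ∷ q)       = ∣p∩q∣≡ᵇ0 p q
  ∣p∩q∣≡ᵇ0 (inside ∷ p)  (inside ∷ q)  = ≡.refl
  ∣p∩q∣≡ᵇ0 (inside ∷ p)  (outside ∷ q) = ∣p∩q∣≡ᵇ0 p q

  elementsOf : ∀ {n} → Subset n → List (Fin n)
  elementsOf {n} I = filter (_∈? I) (allFin n)

  length-elementsOf : ∀ {n} (I : Subset n) → length (elementsOf I) ≡ ∣ I ∣
  length-elementsOf {n} I = ≡.trans (length-filter (_∈? I) (allFin n)) (count-members I)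
    where
    open Sums ℕ.+-*-commutativeSemiring using (Σ-allFin-suc; when)
    length-filter : ∀ {a p} {A : Set a} {P : A → Set p} (P? : ∀ x → Dec (P x)) xs →
                    length (filter P? xs) ≡ count (λ x → does (P? x)) xs
    length-filter P? []       = ≡.refl
    length-filter P? (x ∷ xs) with does (P? x)
    ... | true  = ≡.cong suc (length-filter P? xs)
    ... | false = length-filter P? xs
    count-members : ∀ {m} (I : Subset m) → count (λ t → does (t ∈? I)) (allFin m) ≡ ∣ I ∣
    count-members []      = ≡.refl
    count-members (s ∷ I) = ≡.trans (Σ-allFin-suc (λ t → when (does (t ∈? (s ∷ I))) 1)) (head+tail s)
      where
      head+tail : ∀ s → when (does (Fin.zero ∈? (s ∷ I))) 1 ℕ.+ count (λ t → does (t ∈? I)) (allFin _) ≡ ∣ s ∷ I ∣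
      head+tail inside  = ≡.cong suc (count-members I)
      head+tail outside = count-members I

open SubsetProperties

module HarmonicComplement {c ℓ} (K : Field c ℓ) where
  open Field K
  open FieldProperties K
  open Harmonic K using (tilde; IsHarmonic)
  open import Data.Fin.Subset using (inside; outside; ∣_∣; _∩_; ∁)
  open import Data.Fin.Subset.Properties using (_⊆?_; ∣p∩q∣≤∣p∣)
  open import Relation.Binary.Reasoning.Setoid setoid

  Σ-allSubsets-suc : ∀ n (g : Subset (suc n) → Carrier) →
    Σ (allSubsets (suc n)) g ≈ Σ (allSubsets n) (g ∘ (outside ∷_)) + Σ (allSubsets n) (g ∘ (inside ∷_))
  Σ-allSubsets-suc n g = trans (Σ-++ (map (outside ∷_) (allSubsets n)) _ g)
                               (+-cong (Σ-map _ (allSubsets n) g) (Σ-map _ (allSubsets n) g))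

  Σ-subsetsOfSize : ∀ {n p} {P : Subset n → Set p} (P? : ∀ Z → Dec (P Z)) d (f : Subset n → Carrier) →
    sumOver (filter P? (subsetsOfSize n d)) f ≈
    Σ (allSubsets n) (λ Z → when (∣ Z ∣ ℕ.≡ᵇ d) (when (does (P? Z)) (f Z)))
  Σ-subsetsOfSize {n} P? d f =
    trans (Σ-filter P? (subsetsOfSize n d) f) (Σ-filter (λ Z → ∣ Z ∣ ℕ.≟ d) (allSubsets n) _)

  Σ-⊆-sameSize : ∀ n (Z : Subset n) (g : Subset n → Carrier) →
    Σ (allSubsets n) (λ Y → when (Y ⊆ᵇ Z ∧ (∣ Y ∣ ℕ.≡ᵇ ∣ Z ∣)) (g Y)) ≈ g Z
  Σ-⊆-sameSize zero    []            g = +-identityʳ _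
  Σ-⊆-sameSize (suc n) (outside ∷ Z) g = begin
    _                            ≈⟨ Σ-allSubsets-suc n _ ⟩
    _ + Σ (allSubsets n) (λ _ → 0#) ≈⟨ +-cong (Σ-⊆-sameSize n Z (g ∘ (outside ∷_))) (Σ-zero (allSubsets n)) ⟩
    g (outside ∷ Z) + 0#         ≈⟨ +-identityʳ _ ⟩
    g (outside ∷ Z)              ∎
  Σ-⊆-sameSize (suc n) (inside ∷ Z) g = begin
    _                            ≈⟨ Σ-allSubsets-suc n _ ⟩
    _ + _                        ≈⟨ +-cong (trans (Σ-cong (allSubsets n) too-small) (Σ-zero (allSubsets n)))
                                           (Σ-⊆-sameSize n Z (g ∘ (inside ∷_))) ⟩
    0# + g (inside ∷ Z)          ≈⟨ +-identityˡ _ ⟩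
    g (inside ∷ Z)               ∎
    where
    too-small : ∀ Y → when (Y ⊆ᵇ Z ∧ (∣ Y ∣ ℕ.≡ᵇ suc ∣ Z ∣)) (g (outside ∷ Y)) ≈ 0#
    too-small Y with Y ⊆ᵇ Z in Y⊆Z
    ... | false = refl
    ... | true = when-false _ (<⇒≡ᵇ-false (ℕ.s≤s (⊆ᵇ⇒∣∣≤ Y Z Y⊆Z)))

  -- Removing one point of Z lowers ∣ Z ∩ S ∣ for the s points of Z ∩ S and keeps it for the others.
  Σ-⊆-oneSmaller : ∀ n (Z S : Subset n) (h : ℕ → Carrier) → let s = ∣ Z ∩ S ∣ in
    Σ (allSubsets n) (λ Y → when (Y ⊆ᵇ Z ∧ (suc ∣ Y ∣ ℕ.≡ᵇ ∣ Z ∣)) (h ∣ Y ∩ S ∣)) ≈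
    ℕ→ s * h (s ∸ 1) + ℕ→ (∣ Z ∣ ∸ s) * h s
  Σ-⊆-oneSmaller zero [] [] h = trans (+-identityˡ _) (sym (trans (+-cong (zeroˡ _) (zeroˡ _)) (+-identityˡ _)))
  Σ-⊆-oneSmaller (suc n) (outside ∷ Z) (_ ∷ S) h = begin
    _                                ≈⟨ Σ-allSubsets-suc n _ ⟩
    _ + Σ (allSubsets n) (λ _ → 0#)  ≈⟨ +-cong (Σ-⊆-oneSmaller n Z S h) (Σ-zero (allSubsets n)) ⟩
    _ + 0#                           ≈⟨ +-identityʳ _ ⟩
    _                                ∎
  Σ-⊆-oneSmaller (suc n) (inside ∷ Z) (inside ∷ S) h = begin
    _                                                        ≈⟨ Σ-allSubsets-suc n _ ⟩
    _ + _                                                    ≈⟨ +-cong (Σ-⊆-sameSize n Z (λ Y → h ∣ Y ∩ S ∣))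
                                                                       (Σ-⊆-oneSmaller n Z S (h ∘ suc)) ⟩
    h s + (ℕ→ s * h (suc (s ∸ 1)) + ℕ→ (∣ Z ∣ ∸ s) * h (suc s)) ≈⟨ +-cong refl (+-cong (pred-suc s) refl) ⟩
    h s + (ℕ→ s * h s + ℕ→ (∣ Z ∣ ∸ s) * h (suc s))          ≈⟨ sym (+-assoc _ _ _) ⟩
    (h s + ℕ→ s * h s) + ℕ→ (∣ Z ∣ ∸ s) * h (suc s)          ≈⟨ +-cong (trans (+-cong (sym (*-identityˡ _)) refl)
                                                                                (sym (distribʳ _ _ _))) refl ⟩
    (1# + ℕ→ s) * h s + ℕ→ (∣ Z ∣ ∸ s) * h (suc s)           ∎
    where
    s : ℕ
    s = ∣ Z ∩ S ∣
    pred-suc : ∀ m → ℕ→ m * h (suc (m ∸ 1)) ≈ ℕ→ m * h m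
    pred-suc zero    = trans (zeroˡ _) (sym (zeroˡ _))
    pred-suc (suc m) = refl
  Σ-⊆-oneSmaller (suc n) (inside ∷ Z) (outside ∷ S) h = begin
    _                                                  ≈⟨ Σ-allSubsets-suc n _ ⟩
    _ + _                                              ≈⟨ +-cong (Σ-⊆-sameSize n Z (λ Y → h ∣ Y ∩ S ∣))
                                                                 (Σ-⊆-oneSmaller n Z S h) ⟩
    h s + (ℕ→ s * h (s ∸ 1) + ℕ→ (∣ Z ∣ ∸ s) * h s)    ≈⟨ +-comm _ _ ⟩
    (ℕ→ s * h (s ∸ 1) + ℕ→ (∣ Z ∣ ∸ s) * h s) + h s    ≈⟨ +-assoc _ _ _ ⟩
    ℕ→ s * h (s ∸ 1) + (ℕ→ (∣ Z ∣ ∸ s) * h s + h s)    ≈⟨ +-cong refl (trans (+-cong refl (sym (*-identityˡ _)))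
                                                                      (trans (sym (distribʳ _ _ _)) (*-cong (+-comm _ _) refl))) ⟩
    ℕ→ s * h (s ∸ 1) + ℕ→ (suc (∣ Z ∣ ∸ s)) * h s      ≡⟨ ≡.cong (λ m → ℕ→ s * h (s ∸ 1) + ℕ→ m * h s)
                                                                (≡.sym (ℕ.+-∸-assoc 1 (∣p∩q∣≤∣p∣ Z S))) ⟩
    ℕ→ s * h (s ∸ 1) + ℕ→ (suc ∣ Z ∣ ∸ s) * h s        ∎
    where
    s : ℕ
    s = ∣ Z ∩ S ∣

  tilde≈Σ : ∀ {n} d (f : Subset n → Carrier) X →
    tilde d f X ≈ Σ (allSubsets n) (λ Z → when (∣ Z ∣ ℕ.≡ᵇ d) (when (Z ⊆ᵇ X) (f Z)))
  tilde≈Σ d f X = Σ-subsetsOfSize (_⊆? X) d f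

  module Layers {n} (d : ℕ) (f : Subset n → Carrier) (S : Subset n) where

    layer : ℕ → Carrier
    layer j = Σ (allSubsets n) (λ Z → when (∣ Z ∣ ℕ.≡ᵇ d) (when (∣ Z ∩ S ∣ ℕ.≡ᵇ j) (f Z)))

    layer-d : layer d ≈ tilde d f S
    layer-d = trans (Σ-cong (allSubsets n) λ Z → when-cong (∣ Z ∣ ℕ.≡ᵇ d) λ ∣Z∣≡ᵇd →
                       reflexive (≡.cong (λ b → when b (f Z))
                         (≡.trans (≡.cong (∣ Z ∩ S ∣ ℕ.≡ᵇ_) (≡.sym (ℕ.≡ᵇ⇒≡ _ _ ∣Z∣≡ᵇd))) (∣p∩q∣≡ᵇ∣p∣ Z S))))
                    (sym (tilde≈Σ d f S))

    layer-0 : layer 0 ≈ tilde d f (∁ S)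
    layer-0 = trans (Σ-cong (allSubsets n) λ Z → when-cong (∣ Z ∣ ℕ.≡ᵇ d) λ _ →
                       reflexive (≡.cong (λ b → when b (f Z)) (∣p∩q∣≡ᵇ0 Z S)))
                    (sym (tilde≈Σ d f (∁ S)))

    private
      δ : ℕ → ℕ → Carrier
      δ j m = when (m ℕ.≡ᵇ j) 1#

      lowered : ∀ j s x → ℕ→ s * δ j (s ∸ 1) * x ≈ ℕ→ (suc j) * when (s ℕ.≡ᵇ suc j) x
      lowered j zero    x = trans (*-cong (zeroˡ _) refl) (trans (zeroˡ _) (sym (zeroʳ _)))
      lowered j (suc s) x with s ℕ.≡ᵇ j in s≡ᵇj
      ... | true  = *-cong (trans (*-identityʳ _) (reflexive (≡.cong (ℕ→ ∘ suc) (≡ᵇ-true⇒≡ s j s≡ᵇj)))) refl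
      ... | false = trans (*-cong (zeroʳ _) refl) (trans (zeroˡ _) (sym (zeroʳ _)))

      kept : ∀ j s x → ℕ→ (d ∸ s) * δ j s * x ≈ ℕ→ (d ∸ j) * when (s ℕ.≡ᵇ j) x
      kept j s x with s ℕ.≡ᵇ j in s≡ᵇj
      ... | true  = *-cong (trans (*-identityʳ _) (reflexive (≡.cong (ℕ→ ∘ (d ∸_)) (≡ᵇ-true⇒≡ s j s≡ᵇj)))) refl
      ... | false = trans (*-cong (zeroʳ _) refl) (trans (zeroˡ _) (sym (zeroʳ _)))

      regroup : ∀ j Z Y → when ((suc ∣ Y ∣ ℕ.≡ᵇ d) ∧ (∣ Y ∩ S ∣ ℕ.≡ᵇ j)) (when (Y ⊆ᵇ Z) (f Z)) ≈
                          when (Y ⊆ᵇ Z ∧ (suc ∣ Y ∣ ℕ.≡ᵇ d)) (δ j ∣ Y ∩ S ∣) * f Z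
      regroup j Z Y with suc ∣ Y ∣ ℕ.≡ᵇ d | ∣ Y ∩ S ∣ ℕ.≡ᵇ j | Y ⊆ᵇ Z
      ... | false | _     | false = sym (zeroˡ _)
      ... | false | _     | true  = sym (zeroˡ _)
      ... | true  | false | false = sym (zeroˡ _)
      ... | true  | false | true  = sym (zeroˡ _)
      ... | true  | true  | false = sym (zeroˡ _)
      ... | true  | true  | true  = sym (*-identityˡ _)

      -- Z enters the harmonicity condition of each of its (d - 1)-subsets Y, weighted by whether ∣ Y ∩ S ∣ = j.
      faces : ∀ j Z →
        Σ (allSubsets n) (λ Y → when ((suc ∣ Y ∣ ℕ.≡ᵇ d) ∧ (∣ Y ∩ S ∣ ℕ.≡ᵇ j)) (when (∣ Z ∣ ℕ.≡ᵇ d) (when (Y ⊆ᵇ Z) (f Z)))) ≈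
        ℕ→ (suc j) * when (∣ Z ∣ ℕ.≡ᵇ d) (when (∣ Z ∩ S ∣ ℕ.≡ᵇ suc j) (f Z)) +
        ℕ→ (d ∸ j) * when (∣ Z ∣ ℕ.≡ᵇ d) (when (∣ Z ∩ S ∣ ℕ.≡ᵇ j) (f Z))
      faces j Z with ∣ Z ∣ ℕ.≡ᵇ d in ∣Z∣≡ᵇd
      ... | false = trans (Σ-cong (allSubsets n) (λ Y → when-zero _))
                          (trans (Σ-zero (allSubsets n)) (sym (trans (+-cong (zeroʳ _) (zeroʳ _)) (+-identityˡ _))))
      ... | true  = begin
        Σ (allSubsets n) (λ Y → when ((suc ∣ Y ∣ ℕ.≡ᵇ d) ∧ (∣ Y ∩ S ∣ ℕ.≡ᵇ j)) (when (Y ⊆ᵇ Z) (f Z)))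
          ≈⟨ Σ-cong (allSubsets n) (regroup j Z) ⟩
        Σ (allSubsets n) (λ Y → when (Y ⊆ᵇ Z ∧ (suc ∣ Y ∣ ℕ.≡ᵇ d)) (δ j ∣ Y ∩ S ∣) * f Z)
          ≡⟨ ≡.cong (λ m → Σ (allSubsets n) (λ Y → when (Y ⊆ᵇ Z ∧ (suc ∣ Y ∣ ℕ.≡ᵇ m)) (δ j ∣ Y ∩ S ∣) * f Z)) (≡.sym ∣Z∣≡d) ⟩
        Σ (allSubsets n) (λ Y → when (Y ⊆ᵇ Z ∧ (suc ∣ Y ∣ ℕ.≡ᵇ ∣ Z ∣)) (δ j ∣ Y ∩ S ∣) * f Z)
          ≈⟨ sym (*-distribʳ-Σ (allSubsets n) _ _) ⟩
        Σ (allSubsets n) (λ Y → when (Y ⊆ᵇ Z ∧ (suc ∣ Y ∣ ℕ.≡ᵇ ∣ Z ∣)) (δ j ∣ Y ∩ S ∣)) * f Z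
          ≈⟨ *-cong (Σ-⊆-oneSmaller n Z S (δ j)) refl ⟩
        (ℕ→ s * δ j (s ∸ 1) + ℕ→ (∣ Z ∣ ∸ s) * δ j s) * f Z
          ≈⟨ distribʳ _ _ _ ⟩
        ℕ→ s * δ j (s ∸ 1) * f Z + ℕ→ (∣ Z ∣ ∸ s) * δ j s * f Z
          ≈⟨ +-cong (lowered j s (f Z)) (trans (reflexive (≡.cong (λ m → ℕ→ (m ∸ s) * δ j s * f Z) ∣Z∣≡d)) (kept j s (f Z))) ⟩
        ℕ→ (suc j) * when (s ℕ.≡ᵇ suc j) (f Z) + ℕ→ (d ∸ j) * when (s ℕ.≡ᵇ j) (f Z) ∎
        where
        s : ℕ
        s = ∣ Z ∩ S ∣
        ∣Z∣≡d : ∣ Z ∣ ≡ d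
        ∣Z∣≡d = ≡ᵇ-true⇒≡ _ _ ∣Z∣≡ᵇd

    layer-recurrence : IsHarmonic d f → ∀ j → ℕ→ (suc j) * layer (suc j) + ℕ→ (d ∸ j) * layer j ≈ 0#
    layer-recurrence harmonic j = begin
      ℕ→ (suc j) * layer (suc j) + ℕ→ (d ∸ j) * layer j
        ≈⟨ +-cong (*-distribˡ-Σ (allSubsets n) _ _) (*-distribˡ-Σ (allSubsets n) _ _) ⟩
      Σ (allSubsets n) _ + Σ (allSubsets n) _
        ≈⟨ sym (Σ-+ (allSubsets n) _ _) ⟩
      Σ (allSubsets n) (λ Z → ℕ→ (suc j) * _ + ℕ→ (d ∸ j) * _)
        ≈⟨ sym (Σ-cong (allSubsets n) (faces j)) ⟩
      Σ (allSubsets n) (λ Z → Σ (allSubsets n) (λ Y → _))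
        ≈⟨ Σ-swap (allSubsets n) (allSubsets n) _ ⟩
      Σ (allSubsets n) (λ Y → Σ (allSubsets n) (λ Z → when ((suc ∣ Y ∣ ℕ.≡ᵇ d) ∧ (∣ Y ∩ S ∣ ℕ.≡ᵇ j)) _))
        ≈⟨ sym (Σ-cong (allSubsets n) (λ Y → when-Σ _ (allSubsets n) _)) ⟩
      Σ (allSubsets n) (λ Y → when ((suc ∣ Y ∣ ℕ.≡ᵇ d) ∧ (∣ Y ∩ S ∣ ℕ.≡ᵇ j))
                               (Σ (allSubsets n) (λ Z → when (∣ Z ∣ ℕ.≡ᵇ d) (when (Y ⊆ᵇ Z) (f Z)))))
        ≈⟨ Σ-cong (allSubsets n) balanced ⟩
      Σ (allSubsets n) (λ _ → 0#)
        ≈⟨ Σ-zero (allSubsets n) ⟩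
      0# ∎
      where
      balanced : ∀ Y → when ((suc ∣ Y ∣ ℕ.≡ᵇ d) ∧ (∣ Y ∩ S ∣ ℕ.≡ᵇ j))
                             (Σ (allSubsets n) (λ Z → when (∣ Z ∣ ℕ.≡ᵇ d) (when (Y ⊆ᵇ Z) (f Z)))) ≈ 0#
      balanced Y with suc ∣ Y ∣ ℕ.≡ᵇ d in ∣Y∣+1≡ᵇd
      ... | false = refl
      ... | true with ∣ Y ∩ S ∣ ℕ.≡ᵇ j
      ...   | false = refl
      ...   | true  = trans (sym (Σ-subsetsOfSize (Y ⊆?_) d f)) (harmonic Y (≡ᵇ-true⇒≡ _ _ ∣Y∣+1≡ᵇd))

    scaled : ℕ → Carrier
    scaled j = ℕ→ (j ! ℕ.* (d ∸ j) !) * layer j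

    scaled-suc : IsHarmonic d f → ∀ j → suc j ≤ d → scaled (suc j) ≈ - scaled j
    scaled-suc harmonic j j<d = begin
      ℕ→ ((suc j ℕ.* j !) ℕ.* B !) * layer (suc j)
        ≈⟨ *-cong (trans (ℕ→-* (suc j ℕ.* j !) (B !)) (*-cong (ℕ→-* (suc j) (j !)) refl)) refl ⟩
      ((ℕ→ (suc j) * ℕ→ (j !)) * ℕ→ (B !)) * layer (suc j)
        ≈⟨ solve 4 (λ m p b a → ((m ⊗ p) ⊗ b) ⊗ a ⊜ (p ⊗ b) ⊗ (m ⊗ a)) refl (ℕ→ (suc j)) (ℕ→ (j !)) (ℕ→ (B !)) (layer (suc j)) ⟩
      (ℕ→ (j !) * ℕ→ (B !)) * (ℕ→ (suc j) * layer (suc j))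
        ≈⟨ *-cong refl (+-inverseˡ-unique _ _ (layer-recurrence harmonic j)) ⟩
      (ℕ→ (j !) * ℕ→ (B !)) * (- (ℕ→ (d ∸ j) * layer j))
        ≈⟨ sym (-‿distribʳ-* _ _) ⟩
      - ((ℕ→ (j !) * ℕ→ (B !)) * (ℕ→ (d ∸ j) * layer j))
        ≈⟨ -‿cong (solve 4 (λ p b m a → (p ⊗ b) ⊗ (m ⊗ a) ⊜ (p ⊗ (m ⊗ b)) ⊗ a) refl (ℕ→ (j !)) (ℕ→ (B !)) (ℕ→ (d ∸ j)) (layer j)) ⟩
      - ((ℕ→ (j !) * (ℕ→ (d ∸ j) * ℕ→ (B !))) * layer j)
        ≈⟨ -‿cong (*-cong (sym (trans (ℕ→-* (j !) ((d ∸ j) !)) (*-cong refl ℕ→[d∸j]!))) refl) ⟩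
      - scaled j ∎
      where
      B : ℕ
      B = d ∸ suc j
      d∸j≡1+B : d ∸ j ≡ suc B
      d∸j≡1+B = ℕ.+-∸-assoc 1 j<d
      ℕ→[d∸j]! : ℕ→ ((d ∸ j) !) ≈ ℕ→ (d ∸ j) * ℕ→ (B !)
      ℕ→[d∸j]! rewrite d∸j≡1+B = ℕ→-* (suc B) (B !)

    scaled-alternates : IsHarmonic d f → ∀ j → j ≤ d → scaled j ≈ pow (- 1#) j * scaled 0
    scaled-alternates harmonic zero    _   = sym (*-identityˡ _)
    scaled-alternates harmonic (suc j) j<d = begin
      scaled (suc j)                     ≈⟨ scaled-suc harmonic j j<d ⟩
      - scaled j                         ≈⟨ -‿cong (scaled-alternates harmonic j (ℕ.<⇒≤ j<d)) ⟩
      - (pow (- 1#) j * scaled 0)        ≈⟨ sym (-1*x≈-x _) ⟩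
      - 1# * (pow (- 1#) j * scaled 0)   ≈⟨ sym (*-assoc _ _ _) ⟩
      pow (- 1#) (suc j) * scaled 0      ∎

  -- Since the layers alternate up to the positive factors j! (d - j)!, the two extreme layers agree up to (-1)^d.
  tilde-∁ : CharZero K → ∀ {n} d (f : Subset n → Carrier) → IsHarmonic d f → ∀ S →
    tilde d f S ≈ pow (- 1#) d * tilde d f (∁ S)
  tilde-∁ char0 d f harmonic S = begin
    tilde d f S                          ≈⟨ sym layer-d ⟩
    layer d                              ≈⟨ *-cancelˡ d!≉0 extremes ⟩
    pow (- 1#) d * layer 0               ≈⟨ *-cong refl layer-0 ⟩
    pow (- 1#) d * tilde d f (∁ S)       ∎
    where
    open Layers d f S
    d!≉0 : ¬ (ℕ→ (d !) ≈ 0#)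
    d!≉0 with d ! | ℕ.1≤n! d
    ... | suc m | _ = char0 m
    extremes : ℕ→ (d !) * layer d ≈ ℕ→ (d !) * (pow (- 1#) d * layer 0)
    extremes = begin
      ℕ→ (d !) * layer d                     ≡⟨ ≡.cong (λ m → ℕ→ m * layer d)
                                                  (≡.sym (≡.trans (≡.cong (λ m → d ! ℕ.* m !) (ℕ.n∸n≡0 d)) (ℕ.*-identityʳ (d !)))) ⟩
      scaled d                               ≈⟨ scaled-alternates harmonic d ℕ.≤-refl ⟩
      pow (- 1#) d * scaled 0                ≡⟨ ≡.cong (λ m → pow (- 1#) d * (ℕ→ m * layer 0)) (ℕ.*-identityˡ (d !)) ⟩
      pow (- 1#) d * (ℕ→ (d !) * layer 0)    ≈⟨ *-left-comm _ _ _ ⟩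
      ℕ→ (d !) * (pow (- 1#) d * layer 0)    ∎

module BinomialExpansion {c ℓ} (K : Field c ℓ) where
  open Field K
  open FieldProperties K
  open HarmonicComplement K using (Σ-allSubsets-suc; tilde≈Σ)
  open Harmonic K using (tilde)
  open import Data.Fin.Subset using (inside; outside; ∣_∣)
  open import Relation.Binary.Reasoning.Setoid setoid

  private
    Σ-∧false : ∀ n (Z : Subset n) (g : Subset n → Carrier) →
               Σ (allSubsets n) (λ J → when (Z ⊆ᵇ J ∧ false) (g J)) ≈ 0#
    Σ-∧false n Z g = trans (Σ-cong (allSubsets n) (λ J → when-false _ (∧-zeroʳ (Z ⊆ᵇ J)))) (Σ-zero (allSubsets n))

  Σ-interval-pow : ∀ n (Z T : Subset n) r →
    Σ (allSubsets n) (λ J → when (Z ⊆ᵇ J ∧ J ⊆ᵇ T) (pow r ∣ J ∣)) ≈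
    when (Z ⊆ᵇ T) (pow r ∣ Z ∣ * pow (1# + r) (∣ T ∣ ∸ ∣ Z ∣))
  Σ-interval-pow zero [] [] r = trans (+-identityʳ _) (sym (*-identityˡ _))
  Σ-interval-pow (suc n) (outside ∷ Z) (outside ∷ T) r = begin
    _        ≈⟨ Σ-allSubsets-suc n _ ⟩
    _ + _    ≈⟨ +-cong (Σ-interval-pow n Z T r) (Σ-∧false n Z _) ⟩
    _ + 0#   ≈⟨ +-identityʳ _ ⟩
    _        ∎
  Σ-interval-pow (suc n) (outside ∷ Z) (inside ∷ T) r = begin
    _                                      ≈⟨ Σ-allSubsets-suc n _ ⟩
    Σ (allSubsets n) (λ J → I J (pow r ∣ J ∣)) + Σ (allSubsets n) (λ J → I J (r * pow r ∣ J ∣))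
                                           ≈⟨ +-cong refl (trans (Σ-cong (allSubsets n) (λ J → sym (when-*ˡ _ _ r)))
                                                                 (sym (*-distribˡ-Σ (allSubsets n) r _))) ⟩
    Σ (allSubsets n) (λ J → I J (pow r ∣ J ∣)) + r * Σ (allSubsets n) (λ J → I J (pow r ∣ J ∣))
                                           ≈⟨ +-cong (Σ-interval-pow n Z T r) (*-cong refl (Σ-interval-pow n Z T r)) ⟩
    when (Z ⊆ᵇ T) V + r * when (Z ⊆ᵇ T) V  ≈⟨ grow ⟩
    when (Z ⊆ᵇ T) (pow r ∣ Z ∣ * pow (1# + r) (suc ∣ T ∣ ∸ ∣ Z ∣)) ∎
    where
    I : Subset n → Carrier → Carrier
    I J = when (Z ⊆ᵇ J ∧ J ⊆ᵇ T)
    V : Carrier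
    V = pow r ∣ Z ∣ * pow (1# + r) (∣ T ∣ ∸ ∣ Z ∣)
    grow : when (Z ⊆ᵇ T) V + r * when (Z ⊆ᵇ T) V ≈ when (Z ⊆ᵇ T) (pow r ∣ Z ∣ * pow (1# + r) (suc ∣ T ∣ ∸ ∣ Z ∣))
    grow with Z ⊆ᵇ T in Z⊆T
    ... | false = trans (+-identityˡ _) (zeroʳ _)
    ... | true rewrite ℕ.+-∸-assoc 1 (⊆ᵇ⇒∣∣≤ Z T Z⊆T) = begin
      V + r * V                                           ≈⟨ +-cong (sym (*-identityˡ V)) refl ⟩
      1# * V + r * V                                      ≈⟨ sym (distribʳ V 1# r) ⟩
      (1# + r) * V                                        ≈⟨ *-left-comm _ _ _ ⟩
      pow r ∣ Z ∣ * pow (1# + r) (suc (∣ T ∣ ∸ ∣ Z ∣))    ∎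
  Σ-interval-pow (suc n) (inside ∷ Z) (outside ∷ T) r =
    trans (Σ-allSubsets-suc n _) (trans (+-cong (Σ-zero (allSubsets n)) (Σ-∧false n Z _)) (+-identityʳ _))
  Σ-interval-pow (suc n) (inside ∷ Z) (inside ∷ T) r = begin
    _                                                    ≈⟨ Σ-allSubsets-suc n _ ⟩
    Σ (allSubsets n) (λ _ → 0#) + Σ (allSubsets n) (λ J → when (Z ⊆ᵇ J ∧ J ⊆ᵇ T) (r * pow r ∣ J ∣))
                                                         ≈⟨ +-cong (Σ-zero (allSubsets n))
                                                                   (trans (Σ-cong (allSubsets n) (λ J → sym (when-*ˡ _ _ r)))
                                                                          (sym (*-distribˡ-Σ (allSubsets n) r _))) ⟩
    0# + r * Σ (allSubsets n) (λ J → when (Z ⊆ᵇ J ∧ J ⊆ᵇ T) (pow r ∣ J ∣))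
                                                         ≈⟨ +-identityˡ _ ⟩
    r * Σ (allSubsets n) (λ J → when (Z ⊆ᵇ J ∧ J ⊆ᵇ T) (pow r ∣ J ∣))
                                                         ≈⟨ *-cong refl (Σ-interval-pow n Z T r) ⟩
    r * when (Z ⊆ᵇ T) (pow r ∣ Z ∣ * pow (1# + r) (∣ T ∣ ∸ ∣ Z ∣))
                                                         ≈⟨ when-*ˡ _ _ r ⟩
    when (Z ⊆ᵇ T) (r * (pow r ∣ Z ∣ * pow (1# + r) (∣ T ∣ ∸ ∣ Z ∣)))
                                                         ≈⟨ when-cong (Z ⊆ᵇ T) (λ _ → sym (*-assoc _ _ _)) ⟩
    when (Z ⊆ᵇ T) ((r * pow r ∣ Z ∣) * pow (1# + r) (∣ T ∣ ∸ ∣ Z ∣)) ∎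

  module Weights (x y : Carrier) (x≉0 : ¬ (x ≈ 0#)) (y≉0 : ¬ (y ≈ 0#)) (x−y≉0 : ¬ ((x − y) ≈ 0#)) where
    open Laurent x x≉0 using () renaming (monomial to x^)
    open Laurent y y≉0 using () renaming (monomial to y^)
    open Laurent (x − y) x−y≉0 using () renaming (monomial to [x−y]^)
    private
      y⁻¹ : Carrier
      y⁻¹ = inv y y≉0
      [x−y]⁻¹ : Carrier
      [x−y]⁻¹ = inv (x − y) x−y≉0
      r : Carrier
      r = (x − y) * y⁻¹

    weight : ∀ {n} → ℕ → Subset n → Carrier
    weight {n} d J = [x−y]^ ∣ J ∣ d * y^ n (∣ J ∣ ℕ.+ d)

    coweight : ∀ {n} → ℕ → Subset n → Carrier
    coweight {n} d T = x^ ∣ T ∣ d * y^ n (∣ T ∣ ℕ.+ d)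

    private
      1+r≈x*y⁻¹ : 1# + r ≈ x * y⁻¹
      1+r≈x*y⁻¹ = begin
        1# + (x − y) * y⁻¹        ≈⟨ +-cong (sym (inv-law y y≉0)) refl ⟩
        y * y⁻¹ + (x − y) * y⁻¹   ≈⟨ sym (distribʳ y⁻¹ y (x − y)) ⟩
        (y + (x − y)) * y⁻¹       ≈⟨ *-cong y+[x−y]≈x refl ⟩
        x * y⁻¹                   ∎
        where
        y+[x−y]≈x : y + (x − y) ≈ x
        y+[x−y]≈x = trans (+-comm _ _) (trans (+-assoc _ _ _) (trans (+-cong refl (-‿inverseˡ y)) (+-identityʳ x)))

      scale : ℕ → ℕ → Carrier
      scale n d = pow [x−y]⁻¹ d * (pow y n * pow y⁻¹ d)

      weight≈ : ∀ {n} d (J : Subset n) → weight d J ≈ pow r ∣ J ∣ * scale n d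
      weight≈ {n} d J = begin
        (pow (x − y) j * pow [x−y]⁻¹ d) * (pow y n * pow y⁻¹ (j ℕ.+ d))
          ≈⟨ *-cong refl (*-cong refl (pow-+ y⁻¹ j d)) ⟩
        (pow (x − y) j * pow [x−y]⁻¹ d) * (pow y n * (pow y⁻¹ j * pow y⁻¹ d))
          ≈⟨ solve 5 (λ a b c e g → (a ⊗ b) ⊗ (c ⊗ (e ⊗ g)) ⊜ (a ⊗ e) ⊗ (b ⊗ (c ⊗ g))) refl
                     (pow (x − y) j) (pow [x−y]⁻¹ d) (pow y n) (pow y⁻¹ j) (pow y⁻¹ d) ⟩
        (pow (x − y) j * pow y⁻¹ j) * scale n d
          ≈⟨ *-cong (sym (pow-* (x − y) y⁻¹ j)) refl ⟩
        pow r j * scale n d ∎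
        where
        j : ℕ
        j = ∣ J ∣

      binomial≈coweight : ∀ n d t → d ≤ t → (pow r d * pow (1# + r) (t ∸ d)) * scale n d ≈ x^ t d * y^ n (t ℕ.+ d)
      binomial≈coweight n d t d≤t = begin
        (pow r d * pow (1# + r) m) * scale n d
          ≈⟨ *-cong (*-cong (pow-* (x − y) y⁻¹ d) (trans (pow-cong m 1+r≈x*y⁻¹) (pow-* x y⁻¹ m))) refl ⟩
        ((pow (x − y) d * pow y⁻¹ d) * (pow x m * pow y⁻¹ m)) * (pow [x−y]⁻¹ d * (pow y n * pow y⁻¹ d))
          ≈⟨ solve 7 (λ a b c e g h i → ((a ⊗ b) ⊗ (c ⊗ e)) ⊗ (g ⊗ (h ⊗ i)) ⊜ (a ⊗ g) ⊗ (c ⊗ (h ⊗ ((b ⊗ e) ⊗ i)))) refl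
                     (pow (x − y) d) (pow y⁻¹ d) (pow x m) (pow y⁻¹ m) (pow [x−y]⁻¹ d) (pow y n) (pow y⁻¹ d) ⟩
        (pow (x − y) d * pow [x−y]⁻¹ d) * (pow x m * (pow y n * ((pow y⁻¹ d * pow y⁻¹ m) * pow y⁻¹ d)))
          ≈⟨ *-cong (Laurent.pow-x*pow-x⁻¹ (x − y) x−y≉0 d)
                    (*-cong refl (*-cong refl (trans (*-cong (sym (pow-+ y⁻¹ d m)) refl) (sym (pow-+ y⁻¹ (d ℕ.+ m) d))))) ⟩
        1# * (pow x m * (pow y n * pow y⁻¹ ((d ℕ.+ m) ℕ.+ d)))
          ≈⟨ *-identityˡ _ ⟩
        pow x m * y^ n ((d ℕ.+ m) ℕ.+ d)
          ≈⟨ *-cong (trans (Laurent.pow≈monomial x x≉0 m)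
                           (Laurent.monomial-≡ x x≉0 m 0 t d (≡.trans (ℕ.+-comm m d) (≡.trans d+m≡t (≡.sym (ℕ.+-identityʳ t))))))
                    (reflexive (≡.cong (λ e → y^ n (e ℕ.+ d)) d+m≡t)) ⟩
        x^ t d * y^ n (t ℕ.+ d) ∎
        where
        m : ℕ
        m = t ∸ d
        d+m≡t : d ℕ.+ m ≡ t
        d+m≡t = ℕ.m+[n∸m]≡n d≤t

    Σ-interval-weight : ∀ {n} d (Z T : Subset n) → ∣ Z ∣ ≡ d →
      Σ (allSubsets n) (λ J → when (Z ⊆ᵇ J ∧ J ⊆ᵇ T) (weight d J)) ≈ when (Z ⊆ᵇ T) (coweight d T)
    Σ-interval-weight {n} d Z T ∣Z∣≡d = begin
      Σ (allSubsets n) (λ J → when (Z ⊆ᵇ J ∧ J ⊆ᵇ T) (weight d J))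
        ≈⟨ Σ-cong (allSubsets n) (λ J → trans (when-cong (Z ⊆ᵇ J ∧ J ⊆ᵇ T) (λ _ → weight≈ d J)) (sym (when-*ʳ _ _ _))) ⟩
      Σ (allSubsets n) (λ J → when (Z ⊆ᵇ J ∧ J ⊆ᵇ T) (pow r ∣ J ∣) * scale n d)
        ≈⟨ sym (*-distribʳ-Σ (allSubsets n) _ _) ⟩
      Σ (allSubsets n) (λ J → when (Z ⊆ᵇ J ∧ J ⊆ᵇ T) (pow r ∣ J ∣)) * scale n d
        ≈⟨ *-cong (Σ-interval-pow n Z T r) refl ⟩
      when (Z ⊆ᵇ T) (pow r ∣ Z ∣ * pow (1# + r) (∣ T ∣ ∸ ∣ Z ∣)) * scale n d
        ≈⟨ when-*ʳ _ _ _ ⟩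
      when (Z ⊆ᵇ T) ((pow r ∣ Z ∣ * pow (1# + r) (∣ T ∣ ∸ ∣ Z ∣)) * scale n d)
        ≈⟨ finish ⟩
      when (Z ⊆ᵇ T) (coweight d T) ∎
      where
      finish : when (Z ⊆ᵇ T) ((pow r ∣ Z ∣ * pow (1# + r) (∣ T ∣ ∸ ∣ Z ∣)) * scale n d) ≈ when (Z ⊆ᵇ T) (coweight d T)
      finish with Z ⊆ᵇ T in Z⊆T
      ... | false = refl
      ... | true rewrite ∣Z∣≡d = binomial≈coweight n d ∣ T ∣ (≡.subst (_≤ ∣ T ∣) ∣Z∣≡d (⊆ᵇ⇒∣∣≤ Z T Z⊆T))

    Σ-⊆-when*weight : ∀ {n} d (Z T : Subset n) a → ∣ Z ∣ ≡ d →
      Σ (allSubsets n) (λ J → when (J ⊆ᵇ T) (when (Z ⊆ᵇ J) a * weight d J)) ≈ when (Z ⊆ᵇ T) a * coweight d T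
    Σ-⊆-when*weight {n} d Z T a ∣Z∣≡d = begin
      Σ (allSubsets n) (λ J → when (J ⊆ᵇ T) (when (Z ⊆ᵇ J) a * weight d J))
        ≈⟨ Σ-cong (allSubsets n) factor ⟩
      Σ (allSubsets n) (λ J → a * when (Z ⊆ᵇ J ∧ J ⊆ᵇ T) (weight d J))
        ≈⟨ sym (*-distribˡ-Σ (allSubsets n) _ _) ⟩
      a * Σ (allSubsets n) (λ J → when (Z ⊆ᵇ J ∧ J ⊆ᵇ T) (weight d J))
        ≈⟨ *-cong refl (Σ-interval-weight d Z T ∣Z∣≡d) ⟩
      a * when (Z ⊆ᵇ T) (coweight d T)
        ≈⟨ trans (when-*ˡ (Z ⊆ᵇ T) _ a) (sym (when-*ʳ (Z ⊆ᵇ T) a _)) ⟩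
      when (Z ⊆ᵇ T) a * coweight d T ∎
      where
      factor : ∀ J → when (J ⊆ᵇ T) (when (Z ⊆ᵇ J) a * weight d J) ≈ a * when (Z ⊆ᵇ J ∧ J ⊆ᵇ T) (weight d J)
      factor J with J ⊆ᵇ T | Z ⊆ᵇ J
      ... | false | false = sym (zeroʳ _)
      ... | false | true  = sym (zeroʳ _)
      ... | true  | false = trans (zeroˡ _) (sym (zeroʳ _))
      ... | true  | true  = refl

    Σ-⊆-tilde*weight : ∀ {n} d (f : Subset n → Carrier) (T : Subset n) →
      Σ (allSubsets n) (λ J → when (J ⊆ᵇ T) (tilde d f J * weight d J)) ≈ tilde d f T * coweight d T
    Σ-⊆-tilde*weight {n} d f T = begin
      Σ (allSubsets n) (λ J → when (J ⊆ᵇ T) (tilde d f J * weight d J))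
        ≈⟨ Σ-cong (allSubsets n) (λ J → when-cong (J ⊆ᵇ T) (λ _ → trans (*-cong (tilde≈Σ d f J) refl) (*-distribʳ-Σ (allSubsets n) _ _))) ⟩
      Σ (allSubsets n) (λ J → when (J ⊆ᵇ T) (Σ (allSubsets n) (λ Z → when (∣ Z ∣ ℕ.≡ᵇ d) (when (Z ⊆ᵇ J) (f Z)) * weight d J)))
        ≈⟨ Σ-cong (allSubsets n) (λ J → when-Σ _ (allSubsets n) _) ⟩
      Σ (allSubsets n) (λ J → Σ (allSubsets n) (λ Z → when (J ⊆ᵇ T) (when (∣ Z ∣ ℕ.≡ᵇ d) (when (Z ⊆ᵇ J) (f Z)) * weight d J)))
        ≈⟨ Σ-swap (allSubsets n) (allSubsets n) _ ⟩
      Σ (allSubsets n) (λ Z → Σ (allSubsets n) (λ J → when (J ⊆ᵇ T) (when (∣ Z ∣ ℕ.≡ᵇ d) (when (Z ⊆ᵇ J) (f Z)) * weight d J)))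
        ≈⟨ Σ-cong (allSubsets n) per-Z ⟩
      Σ (allSubsets n) (λ Z → when (∣ Z ∣ ℕ.≡ᵇ d) (when (Z ⊆ᵇ T) (f Z)) * coweight d T)
        ≈⟨ sym (*-distribʳ-Σ (allSubsets n) _ _) ⟩
      Σ (allSubsets n) (λ Z → when (∣ Z ∣ ℕ.≡ᵇ d) (when (Z ⊆ᵇ T) (f Z))) * coweight d T
        ≈⟨ *-cong (sym (tilde≈Σ d f T)) refl ⟩
      tilde d f T * coweight d T ∎
      where
      per-Z : ∀ Z → Σ (allSubsets n) (λ J → when (J ⊆ᵇ T) (when (∣ Z ∣ ℕ.≡ᵇ d) (when (Z ⊆ᵇ J) (f Z)) * weight d J)) ≈
                    when (∣ Z ∣ ℕ.≡ᵇ d) (when (Z ⊆ᵇ T) (f Z)) * coweight d T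
      per-Z Z with ∣ Z ∣ ℕ.≡ᵇ d in ∣Z∣≡ᵇd
      ... | false = trans (Σ-cong (allSubsets n) (λ J → trans (when-cong (J ⊆ᵇ T) (λ _ → zeroˡ _)) (when-zero (J ⊆ᵇ T))))
                          (trans (Σ-zero (allSubsets n)) (sym (zeroˡ _)))
      ... | true  = Σ-⊆-when*weight d Z T (f Z) (≡ᵇ-true⇒≡ _ _ ∣Z∣≡ᵇd)

module Counting {c ℓ} (F : FiniteField c ℓ) where
  open FiniteField F
  open Sums ℕ.+-*-commutativeSemiring
  open import Data.Empty using (⊥-elim)
  open import Data.List using (length)
  open import Data.List.Relation.Unary.All as All using (All; _∷_)
  open import Data.List.Relation.Unary.All.Properties using (All¬⇒¬Any)
  open import Data.List.Relation.Unary.Any using (Any)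
  open import Data.List.Relation.Unary.AllPairs using (_∷_)
  open import Data.List.Relation.Unary.Unique.Setoid setoid using (Unique)
  open import Data.Vec using (zipWith)
  open import Data.Vec.Relation.Binary.Pointwise.Inductive as Pointwise using (Pointwise; _∷_)
  open import Function.Bundles using (_⇔_; mk⇔)
  open import Relation.Nullary using (yes; no)
  open import Relation.Nullary.Decidable using (does-⇔)
  open ≡.≡-Reasoning

  count-cong : ∀ {a} {A : Set a} (xs : List A) {p p′ : A → Bool} → (∀ x → p x ≡ p′ x) → count p xs ≡ count p′ xs
  count-cong xs p≡p′ = Σ-cong xs (λ x → ≡.cong (λ b → when b 1) (p≡p′ x))

  Σ-const : ∀ {a} {A : Set a} (xs : List A) m → Σ xs (λ _ → m) ≡ length xs ℕ.* m
  Σ-const []       m = ≡.refl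
  Σ-const (x ∷ xs) m = ≡.cong (m ℕ.+_) (Σ-const xs m)

  Respects≈ : ∀ {b} {B : Set b} → (Carrier → B) → Set _
  Respects≈ h = ∀ {u v} → u ≈ v → h u ≡ h v

  private
    Σ-point-absent : ∀ xs x (g : Carrier → ℕ) → All (λ b → ¬ (b ≈ x)) xs →
                     Σ xs (λ b → when (does (b ≟ x)) (g b)) ≡ 0
    Σ-point-absent []       x g All.[]        = ≡.refl
    Σ-point-absent (b ∷ bs) x g (b≉x ∷ bs≉x) with b ≟ x
    ... | yes b≈x = ⊥-elim (b≉x b≈x)
    ... | no  _   = Σ-point-absent bs x g bs≉x

    Σ-point-unique : ∀ xs x (g : Carrier → ℕ) → Respects≈ g → Unique xs → Any (x ≈_) xs →
                     Σ xs (λ b → when (does (b ≟ x)) (g b)) ≡ g x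
    Σ-point-unique (b ∷ bs) x g g-resp (b≉bs ∷ _) (here x≈b) with b ≟ x
    ... | yes b≈x = ≡.trans (≡.cong₂ ℕ._+_ (g-resp b≈x)
                                           (Σ-point-absent bs x g (All.map (λ b≉b′ b′≈x → b≉b′ (sym (trans b′≈x x≈b))) b≉bs)))
                            (ℕ.+-identityʳ (g x))
    ... | no  b≉x = ⊥-elim (b≉x (sym x≈b))
    Σ-point-unique (b ∷ bs) x g g-resp (b≉bs ∷ bs-unique) (there x∈bs) with b ≟ x
    ... | yes b≈x = ⊥-elim (All¬⇒¬Any (All.map (λ b≉b′ x≈b′ → b≉b′ (trans b≈x x≈b′)) b≉bs) x∈bs)
    ... | no  _   = Σ-point-unique bs x g g-resp bs-unique x∈bs

  Σ-point : ∀ x (g : Carrier → ℕ) → Respects≈ g → Σ elements (λ b → when (does (b ≟ x)) (g b)) ≡ g x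
  Σ-point x g g-resp = Σ-point-unique elements x g g-resp elements-unique (elements-complete x)

  Σ-translate : ∀ (h : Carrier → ℕ) → Respects≈ h → ∀ s → Σ elements (λ a → h (a + s)) ≡ Σ elements h
  Σ-translate h h-resp s = begin
    Σ elements (λ a → h (a + s))
      ≡⟨ Σ-cong elements (λ a → ≡.sym (Σ-point (a + s) h h-resp)) ⟩
    Σ elements (λ a → Σ elements (λ b → when (does (b ≟ (a + s))) (h b)))
      ≡⟨ Σ-swap elements elements _ ⟩
    Σ elements (λ b → Σ elements (λ a → when (does (b ≟ (a + s))) (h b)))
      ≡⟨ Σ-cong elements (λ b → ≡.trans (Σ-cong elements (λ a → ≡.cong (λ t → when t (h b)) (does-⇔ (b≈a+s⇔a≈b−s a b) (b ≟ (a + s)) (a ≟ (b − s)))))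
                                        (Σ-point (b − s) (λ _ → h b) (λ _ → ≡.refl))) ⟩
    Σ elements h ∎
    where
    b≈a+s⇔a≈b−s : ∀ a b → b ≈ a + s ⇔ a ≈ b − s
    b≈a+s⇔a≈b−s a b = mk⇔
      (λ b≈a+s → sym (trans (+-cong b≈a+s refl) (trans (+-assoc _ _ _) (trans (+-cong refl (-‿inverseʳ s)) (+-identityʳ a)))))
      (λ a≈b−s → sym (trans (+-cong a≈b−s refl) (trans (+-assoc _ _ _) (trans (+-cong refl (-‿inverseˡ s)) (+-identityʳ b)))))

  q≥2 : 2 ≤ q
  q≥2 = two-distinct elements (elements-complete 0#) (elements-complete 1#)
    where
    two-distinct : ∀ xs → Any (0# ≈_) xs → Any (1# ≈_) xs → 2 ≤ length xs
    two-distinct (_ ∷ _ ∷ _) _         _         = ℕ.s≤s (ℕ.s≤s ℕ.z≤n)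
    two-distinct (_ ∷ [])    (here 0≈) (here 1≈) = ⊥-elim (0≉1 (trans 0≈ (sym 1≈)))

  _+ᵥ_ : ∀ {k} → Vec Carrier k → Vec Carrier k → Vec Carrier k
  _+ᵥ_ = zipWith _+_

  RespectsPointwise : ∀ {k} → (Vec Carrier k → Bool) → Set _
  RespectsPointwise p = ∀ {u v} → Pointwise _≈_ u v → p u ≡ p v

  count-vecs-suc : ∀ k (p : Vec Carrier (suc k) → Bool) →
    count p (vecs elements (suc k)) ≡ Σ elements (λ a → count (p ∘ (a ∷_)) (vecs elements k))
  count-vecs-suc k p = ≡.trans (Σ-concatMap (λ a → map (a ∷_) (vecs elements k)) elements _)
                               (Σ-cong elements (λ a → Σ-map (a ∷_) (vecs elements k) _))

  count-translate : ∀ k (p : Vec Carrier k → Bool) → RespectsPointwise p → ∀ t →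
    count (λ m → p (m +ᵥ t)) (vecs elements k) ≡ count p (vecs elements k)
  count-translate zero    p p-resp []      = ≡.refl
  count-translate (suc k) p p-resp (t₀ ∷ t) = begin
    count (λ m → p (m +ᵥ (t₀ ∷ t))) (vecs elements (suc k))
      ≡⟨ count-vecs-suc k _ ⟩
    Σ elements (λ a → count (λ v → p ((a + t₀) ∷ (v +ᵥ t))) (vecs elements k))
      ≡⟨ Σ-cong elements (λ a → count-translate k (p ∘ ((a + t₀) ∷_)) (λ u≈v → p-resp (refl ∷ u≈v)) t) ⟩
    Σ elements (λ a → H (a + t₀))
      ≡⟨ Σ-translate H (λ a≈b → count-cong (vecs elements k) (λ v → p-resp (a≈b ∷ Pointwise.refl refl))) t₀ ⟩
    Σ elements H
      ≡⟨ ≡.sym (count-vecs-suc k p) ⟩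
    count p (vecs elements (suc k)) ∎
    where
    H : Carrier → ℕ
    H a = count (p ∘ (a ∷_)) (vecs elements k)

  count-all : ∀ k → count (λ _ → true) (vecs elements k) ≡ q ℕ.^ k
  count-all zero    = ≡.refl
  count-all (suc k) = ≡.trans (count-vecs-suc k _)
                              (≡.trans (Σ-cong elements (λ _ → count-all k)) (Σ-const elements (q ℕ.^ k)))

  isZeroᵇ : ∀ {k} → Vec Carrier k → Bool
  isZeroᵇ []      = true
  isZeroᵇ (a ∷ v) = does (a ≟ 0#) ∧ isZeroᵇ v

  count-isZero : ∀ k → count isZeroᵇ (vecs elements k) ≡ 1
  count-isZero zero    = ≡.refl
  count-isZero (suc k) = ≡.trans (count-vecs-suc k _)
                                 (≡.trans (Σ-cong elements rest) (Σ-point 0# (λ _ → 1) (λ _ → ≡.refl)))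
    where
    rest : ∀ a → count (λ v → does (a ≟ 0#) ∧ isZeroᵇ v) (vecs elements k) ≡ when (does (a ≟ 0#)) 1
    rest a with does (a ≟ 0#)
    ... | true  = count-isZero k
    ... | false = Σ-zero (vecs elements k)

  count-fibres : ∀ {a} {A : Set a} (xs : List A) (p : A → Bool) (φ : A → Carrier) →
    count p xs ≡ Σ elements (λ b → count (λ m → p m ∧ does (φ m ≟ b)) xs)
  count-fibres xs p φ = ≡.sym (≡.trans (Σ-swap elements xs _) (Σ-cong xs one-fibre))
    where
    one-fibre : ∀ m → Σ elements (λ b → when (p m ∧ does (φ m ≟ b)) 1) ≡ when (p m) 1
    one-fibre m with p m
    ... | false = Σ-zero elements
    ... | true  = ≡.trans (Σ-cong elements (λ b → ≡.cong (λ t → when t 1) (does-⇔ (mk⇔ sym sym) (φ m ≟ b) (b ≟ φ m))))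
                          (Σ-point (φ m) (λ _ → 1) (λ _ → ≡.refl))

module ColumnSpace {c ℓ} (F : FiniteField c ℓ) {k n : ℕ} (G : Code.Matrix F k n) where
  open FiniteField F
  open FieldProperties field′
  open Counting F using (_+ᵥ_)
  import Data.Fin.Properties as Fin
  open import Data.Product using (Σ-syntax; ∃; _×_; _,_; proj₁; proj₂)
  open import Data.Unit using (⊤)
  open import Data.Vec as Vec using (lookup; tabulate)
  import Data.Vec.Properties as Vec
  open import Data.Vec.Functional using (updateAt)
  open import Data.Vec.Functional.Properties using (updateAt-updates; updateAt-minimal)
  open import Data.Vec.Relation.Binary.Pointwise.Inductive as Pointwise using (Pointwise)
  open import Data.Bool.Properties using (T-∧)
  open import Function.Bundles using (mk⇔; module Equivalence)
  open import Relation.Nullary using (yes; no)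
  open import Relation.Nullary.Decidable using (does-⇔)
  open import Relation.Binary.Reasoning.Setoid setoid

  col : Fin n → Fin k → Carrier
  col j i = G i j

  dot : Vec Carrier k → (Fin k → Carrier) → Carrier
  dot m v = Σ (allFin k) (λ i → lookup m i * v i)

  _·ᵥ_ : Carrier → Vec Carrier k → Vec Carrier k
  s ·ᵥ m = Vec.map (s *_) m

  unit : Fin k → Vec Carrier k
  unit i = tabulate (λ r → when (does (r Fin.≟ i)) 1#)

  dot-cong : ∀ {m m′} v → Pointwise _≈_ m m′ → dot m v ≈ dot m′ v
  dot-cong v m≈m′ = Σ-cong (allFin k) (λ i → *-cong (Pointwise.lookup m≈m′ i) refl)

  dot-+ᵥ : ∀ m m′ v → dot (m +ᵥ m′) v ≈ dot m v + dot m′ v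
  dot-+ᵥ m m′ v = trans (Σ-cong (allFin k) (λ i → trans (*-cong (reflexive (Vec.lookup-zipWith _+_ i m m′)) refl) (distribʳ _ _ _)))
                        (Σ-+ (allFin k) _ _)

  dot-·ᵥ : ∀ s m v → dot (s ·ᵥ m) v ≈ s * dot m v
  dot-·ᵥ s m v = trans (Σ-cong (allFin k) (λ i → trans (*-cong (reflexive (Vec.lookup-map i (s *_) m)) refl) (*-assoc _ _ _)))
                       (sym (*-distribˡ-Σ (allFin k) s _))

  dot-linearʳ : ∀ m v w s → dot m (λ i → v i + s * w i) ≈ dot m v + s * dot m w
  dot-linearʳ m v w s = trans (Σ-cong (allFin k) (λ i → trans (distribˡ _ _ _) (+-cong refl (*-left-comm _ _ _))))
                              (trans (Σ-+ (allFin k) _ _) (+-cong refl (sym (*-distribˡ-Σ (allFin k) s _))))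

  dot-zeroʳ : ∀ m v → (∀ i → v i ≈ 0#) → dot m v ≈ 0#
  dot-zeroʳ m v v≈0 = trans (Σ-cong (allFin k) (λ i → trans (*-cong refl (v≈0 i)) (zeroʳ _))) (Σ-zero (allFin k))

  dot-zeroˡ : ∀ m v → (∀ i → lookup m i ≈ 0#) → dot m v ≈ 0#
  dot-zeroˡ m v m≈0 = trans (Σ-cong (allFin k) (λ i → trans (*-cong (m≈0 i) refl) (zeroˡ _))) (Σ-zero (allFin k))

  dot-combination : ∀ m js (a : Fin n → Carrier) →
    dot m (λ i → Σ js (λ t → a t * G i t)) ≈ Σ js (λ t → a t * dot m (col t))
  dot-combination m js a = begin
    Σ (allFin k) (λ i → lookup m i * Σ js (λ t → a t * G i t))   ≈⟨ Σ-cong (allFin k) (λ i → *-distribˡ-Σ js _ _) ⟩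
    Σ (allFin k) (λ i → Σ js (λ t → lookup m i * (a t * G i t)))  ≈⟨ Σ-swap (allFin k) js _ ⟩
    Σ js (λ t → Σ (allFin k) (λ i → lookup m i * (a t * G i t)))  ≈⟨ Σ-cong js (λ t → trans (Σ-cong (allFin k) (λ i → *-left-comm _ _ _))
                                                                                            (sym (*-distribˡ-Σ (allFin k) (a t) _))) ⟩
    Σ js (λ t → a t * dot m (col t))                              ∎

  Σ-allFin-point : ∀ {m} (i : Fin m) (g : Fin m → Carrier) → Σ (allFin m) (λ r → when (does (r Fin.≟ i)) (g r)) ≈ g i
  Σ-allFin-point {suc m} i g = trans (Σ-allFin-suc (λ r → when (does (r Fin.≟ i)) (g r))) (at i)
    where
    at : ∀ i → when (does (Fin.zero Fin.≟ i)) (g Fin.zero) +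
               Σ (allFin m) (λ r → when (does (Fin.suc r Fin.≟ i)) (g (Fin.suc r))) ≈ g i
    at Fin.zero    = trans (+-cong refl (Σ-zero (allFin m))) (+-identityʳ _)
    at (Fin.suc i) = trans (+-identityˡ _) (Σ-allFin-point i (g ∘ Fin.suc))

  dot-unit : ∀ i v → dot (unit i) v ≈ v i
  dot-unit i v = trans (Σ-cong (allFin k) (λ r → trans (*-cong (reflexive (Vec.lookup∘tabulate _ r)) refl)
                                                  (trans (when-*ʳ _ 1# (v r)) (when-cong _ (λ _ → *-identityˡ _)))))
                       (Σ-allFin-point i v)

  InSpan : List (Fin n) → (Fin k → Carrier) → Set (c ⊔ ℓ)
  InSpan js v = ∃ λ (a : Fin n → Carrier) → ∀ i → v i ≈ Σ js (λ j → a j * G i j)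

  Independent : List (Fin n) → Set (c ⊔ ℓ)
  Independent []       = Lift (c ⊔ ℓ) ⊤
  Independent (j ∷ js) = ¬ j ∈ₗ js × ¬ InSpan js (col j) × Independent js

  Orthogonal : List (Fin n) → Vec Carrier k → Set ℓ
  Orthogonal js w = ∀ j → j ∈ₗ js → dot w (col j) ≈ 0#

  Σ-updateAt : ∀ j js (a : Fin n → Carrier) μ (g : Fin n → Carrier) → ¬ j ∈ₗ js →
    Σ (j ∷ js) (λ t → updateAt a j (λ _ → μ) t * g t) ≈ μ * g j + Σ js (λ t → a t * g t)
  Σ-updateAt j js a μ g j∉js =
    +-cong (*-cong (reflexive (updateAt-updates j a)) refl)
           (Σ-cong-∈ js (λ t t∈js → *-cong (reflexive (updateAt-minimal t j a (λ { ≡.refl → j∉js t∈js }))) refl))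

  private
    normalise : ∀ js w v → Orthogonal js w → ¬ (dot w v ≈ 0#) →
                Σ[ w′ ∈ Vec Carrier k ] Orthogonal js w′ × dot w′ v ≈ 1#
    normalise js w v w⊥js w·v≉0 =
      inv (dot w v) w·v≉0 ·ᵥ w ,
      (λ j j∈js → trans (dot-·ᵥ _ w (col j)) (trans (*-cong refl (w⊥js j j∈js)) (zeroʳ _))) ,
      trans (dot-·ᵥ _ w v) (trans (*-comm _ _) (inv-law _ w·v≉0))

    x≈[x-μy]+μy : ∀ μ x y → x ≈ (x + (- μ) * y) + μ * y
    x≈[x-μy]+μy μ x y = sym (begin
      (x + (- μ) * y) + μ * y   ≈⟨ +-assoc _ _ _ ⟩
      x + ((- μ) * y + μ * y)   ≈⟨ +-cong refl (sym (distribʳ y (- μ) μ)) ⟩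
      x + (- μ + μ) * y         ≈⟨ +-cong refl (trans (*-cong (-‿inverseˡ μ) refl) (zeroˡ y)) ⟩
      x + 0#                    ≈⟨ +-identityʳ x ⟩
      x                         ∎)

    ∉span-∷ : ∀ j js → ¬ j ∈ₗ js → ∀ v μ → ¬ InSpan (j ∷ js) v → ¬ InSpan js (λ i → v i + (- μ) * col j i)
    ∉span-∷ j js j∉js v μ v∉span (a , v−μcⱼ≈Σ) = v∉span (updateAt a j (λ _ → μ) , λ i → begin
      v i                                                 ≈⟨ x≈[x-μy]+μy μ (v i) (G i j) ⟩
      (v i + (- μ) * G i j) + μ * G i j                   ≈⟨ +-cong (v−μcⱼ≈Σ i) refl ⟩
      Σ js (λ t → a t * G i t) + μ * G i j                ≈⟨ +-comm _ _ ⟩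
      μ * G i j + Σ js (λ t → a t * G i t)                ≈⟨ sym (Σ-updateAt j js a μ (G i) j∉js) ⟩
      Σ (j ∷ js) (λ t → updateAt a j (λ _ → μ) t * G i t) ∎)

    -- w₁ corrected by a vector w′ dual to column j, so as to become orthogonal to column j too.
    corrected : Fin n → Vec Carrier k → Vec Carrier k → Vec Carrier k
    corrected j w′ w₁ = w₁ +ᵥ ((- dot w₁ (col j)) ·ᵥ w′)

    dot-corrected : ∀ j w′ w₁ u → dot (corrected j w′ w₁) u ≈ dot w₁ u + (- dot w₁ (col j)) * dot w′ u
    dot-corrected j w′ w₁ u = trans (dot-+ᵥ w₁ _ u) (+-cong refl (dot-·ᵥ _ w′ u))

    corrected-⊥ : ∀ j js w′ w₁ → Orthogonal js w′ → dot w′ (col j) ≈ 1# → Orthogonal js w₁ →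
                  Orthogonal (j ∷ js) (corrected j w′ w₁)
    corrected-⊥ j js w′ w₁ w′⊥js w′·cⱼ≈1 w₁⊥js t (here ≡.refl) = begin
      dot (corrected j w′ w₁) (col j)  ≈⟨ dot-corrected j w′ w₁ (col j) ⟩
      δ + (- δ) * dot w′ (col j)       ≈⟨ +-cong refl (trans (*-cong refl w′·cⱼ≈1) (*-identityʳ _)) ⟩
      δ + (- δ)                        ≈⟨ -‿inverseʳ δ ⟩
      0#                               ∎
      where
      δ : Carrier
      δ = dot w₁ (col j)
    corrected-⊥ j js w′ w₁ w′⊥js w′·cⱼ≈1 w₁⊥js t (there t∈js) = begin
      dot (corrected j w′ w₁) (col t)                       ≈⟨ dot-corrected j w′ w₁ (col t) ⟩
      dot w₁ (col t) + (- dot w₁ (col j)) * dot w′ (col t)  ≈⟨ +-cong (w₁⊥js t t∈js) (trans (*-cong refl (w′⊥js t t∈js)) (zeroʳ _)) ⟩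
      0# + 0#                                               ≈⟨ +-identityʳ _ ⟩
      0#                                                    ∎

    dot-corrected≈ : ∀ j w′ w₁ v → dot (corrected j w′ w₁) v ≈ dot w₁ (λ i → v i + (- dot w′ v) * col j i)
    dot-corrected≈ j w′ w₁ v = begin
      dot (corrected j w′ w₁) v    ≈⟨ dot-corrected j w′ w₁ v ⟩
      dot w₁ v + (- δ) * μ         ≈⟨ +-cong refl (trans (sym (-‿distribˡ-* δ μ)) (trans (-‿cong (*-comm δ μ)) (-‿distribˡ-* μ δ))) ⟩
      dot w₁ v + (- μ) * δ         ≈⟨ sym (dot-linearʳ w₁ v (col j) (- μ)) ⟩
      dot w₁ (λ i → v i + (- μ) * col j i) ∎
      where
      δ μ : Carrier
      δ = dot w₁ (col j)
      μ = dot w′ v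

  mutual
    separating-vector : ∀ js → Independent js → ∀ v → ¬ InSpan js v →
                        Σ[ w ∈ Vec Carrier k ] Orthogonal js w × ¬ (dot w v ≈ 0#)
    separating-vector [] _ v v∉span
      with Fin.¬∀⟶∃¬ k (λ i → v i ≈ 0#) (λ i → v i ≟ 0#) (λ v≈0 → v∉span ((λ _ → 0#) , v≈0))
    ... | i , vᵢ≉0 = unit i , (λ _ ()) , (λ w·v≈0 → vᵢ≉0 (trans (sym (dot-unit i v)) w·v≈0))
    -- Separate v minus its component along column j from the remaining columns, then correct.
    separating-vector (j ∷ js) ind@(j∉js , _ , ind′) v v∉span with dual-vector j js ind
    ... | w′ , w′⊥js , w′·cⱼ≈1 with separating-vector js ind′ _ (∉span-∷ j js j∉js v (dot w′ v) v∉span)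
    ...   | w₁ , w₁⊥js , w₁·b≉0 =
      corrected j w′ w₁ , corrected-⊥ j js w′ w₁ w′⊥js w′·cⱼ≈1 w₁⊥js ,
      (λ w·v≈0 → w₁·b≉0 (trans (sym (dot-corrected≈ j w′ w₁ v)) w·v≈0))

    dual-vector : ∀ j js → Independent (j ∷ js) → Σ[ w ∈ Vec Carrier k ] Orthogonal js w × dot w (col j) ≈ 1#
    dual-vector j js (_ , cⱼ∉span , ind) with separating-vector js ind (col j) cⱼ∉span
    ... | w , w⊥js , w·cⱼ≉0 = normalise js w (col j) w⊥js w·cⱼ≉0

  orthogonalᵇ : List (Fin n) → Vec Carrier k → Bool
  orthogonalᵇ []       m = true
  orthogonalᵇ (j ∷ js) m = does (dot m (col j) ≟ 0#) ∧ orthogonalᵇ js m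

  T-≟0⇒≈0 : ∀ {x} → T (does (x ≟ 0#)) → x ≈ 0#
  T-≟0⇒≈0 {x} _ with x ≟ 0#
  ... | yes x≈0 = x≈0

  ≈0⇒T-≟0 : ∀ {x} → x ≈ 0# → T (does (x ≟ 0#))
  ≈0⇒T-≟0 {x} x≈0 with x ≟ 0#
  ... | yes _   = _
  ... | no x≉0 = x≉0 x≈0

  orthogonalᵇ⇒Orthogonal : ∀ js m → T (orthogonalᵇ js m) → Orthogonal js m
  orthogonalᵇ⇒Orthogonal (j ∷ js) m ⊥ᵇ t (here ≡.refl) = T-≟0⇒≈0 (proj₁ (T-∧ .Equivalence.to ⊥ᵇ))
  orthogonalᵇ⇒Orthogonal (j ∷ js) m ⊥ᵇ t (there t∈js) = orthogonalᵇ⇒Orthogonal js m (proj₂ (T-∧ .Equivalence.to ⊥ᵇ)) t t∈js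

  Orthogonal⇒orthogonalᵇ : ∀ js m → Orthogonal js m → T (orthogonalᵇ js m)
  Orthogonal⇒orthogonalᵇ []       m _  = _
  Orthogonal⇒orthogonalᵇ (j ∷ js) m m⊥ = T-∧ .Equivalence.from
    (≈0⇒T-≟0 (m⊥ j (here ≡.refl)) , Orthogonal⇒orthogonalᵇ js m (λ t t∈js → m⊥ t (there t∈js)))

  private
    does≈0-cong : ∀ {x y} → x ≈ y → does (x ≟ 0#) ≡ does (y ≟ 0#)
    does≈0-cong {x} {y} x≈y = does-⇔ (mk⇔ (trans (sym x≈y)) (trans x≈y)) (x ≟ 0#) (y ≟ 0#)

  orthogonalᵇ-ext : ∀ js m m′ → (∀ j → j ∈ₗ js → dot m (col j) ≈ dot m′ (col j)) → orthogonalᵇ js m ≡ orthogonalᵇ js m′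
  orthogonalᵇ-ext []       m m′ _     = ≡.refl
  orthogonalᵇ-ext (j ∷ js) m m′ m≈m′ =
    ≡.cong₂ _∧_ (does≈0-cong (m≈m′ j (here ≡.refl))) (orthogonalᵇ-ext js m m′ (λ t t∈js → m≈m′ t (there t∈js)))

module OrthogonalCount {c ℓ} (F : FiniteField c ℓ) {k n : ℕ} (G : Code.Matrix F k n) where
  open FiniteField F
  open ColumnSpace F G
  open Counting F
  open Sums ℕ.+-*-commutativeSemiring using (Σ; Σ-cong)
  open import Data.Bool.Properties using (∧-comm)
  open import Data.List using (length)
  open import Data.Product using (Σ-syntax; _×_; _,_; proj₁; proj₂)
  open import Function.Bundles using (mk⇔)
  open import Relation.Nullary.Decidable using (does-⇔)
  open RingProperties ring using (+-cancelʳ)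
  open ≡.≡-Reasoning

  -- The translations m ↦ m + a w, for w dual to column j, match the fibre of m ↦ m ⬝ cⱼ over a with the fibre over 0.
  count-orthogonal-∷ : ∀ j js → Independent (j ∷ js) →
    count (orthogonalᵇ js) (vecs elements k) ≡ q ℕ.* count (orthogonalᵇ (j ∷ js)) (vecs elements k)
  count-orthogonal-∷ j js ind = begin
    count (orthogonalᵇ js) (vecs elements k)
      ≡⟨ count-fibres (vecs elements k) (orthogonalᵇ js) φ ⟩
    Σ elements (λ a → count (fibre a) (vecs elements k))
      ≡⟨ Σ-cong elements (λ a → ≡.sym (count-translate k (fibre a) (fibre-resp a) (a ·ᵥ w))) ⟩
    Σ elements (λ a → count (λ m → fibre a (m +ᵥ (a ·ᵥ w))) (vecs elements k))
      ≡⟨ Σ-cong elements (λ a → count-cong (vecs elements k) (translated-fibre a)) ⟩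
    Σ elements (λ _ → count (orthogonalᵇ (j ∷ js)) (vecs elements k))
      ≡⟨ Σ-const elements _ ⟩
    q ℕ.* count (orthogonalᵇ (j ∷ js)) (vecs elements k) ∎
    where
    φ : Vec Carrier k → Carrier
    φ m = dot m (col j)
    dual : Σ[ w ∈ Vec Carrier k ] Orthogonal js w × dot w (col j) ≈ 1#
    dual = dual-vector j js ind
    w : Vec Carrier k
    w = proj₁ dual
    fibre : Carrier → Vec Carrier k → Bool
    fibre a m = orthogonalᵇ js m ∧ does (φ m ≟ a)
    fibre-resp : ∀ a → RespectsPointwise (fibre a)
    fibre-resp a {m} {m′} m≈m′ = ≡.cong₂ _∧_ (orthogonalᵇ-ext js _ _ (λ t _ → dot-cong (col t) m≈m′))
                                    (does-⇔ (mk⇔ (trans (sym (dot-cong (col j) m≈m′))) (trans (dot-cong (col j) m≈m′))) (φ m ≟ a) (φ m′ ≟ a))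
    shift : ∀ a m t → dot (m +ᵥ (a ·ᵥ w)) (col t) ≈ dot m (col t) + a * dot w (col t)
    shift a m t = trans (dot-+ᵥ m (a ·ᵥ w) (col t)) (+-cong refl (dot-·ᵥ a w (col t)))
    translated-fibre : ∀ a m → fibre a (m +ᵥ (a ·ᵥ w)) ≡ orthogonalᵇ (j ∷ js) m
    translated-fibre a m = ≡.trans
      (≡.cong₂ _∧_ (orthogonalᵇ-ext js _ m (λ t t∈js → trans (shift a m t)
                      (trans (+-cong refl (trans (*-cong refl (proj₁ (proj₂ dual) t t∈js)) (zeroʳ a))) (+-identityʳ _))))
                   (does-⇔ (mk⇔ to from) (φ (m +ᵥ (a ·ᵥ w)) ≟ a) (φ m ≟ 0#)))
      (∧-comm (orthogonalᵇ js m) _)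
      where
      φ-shift : φ (m +ᵥ (a ·ᵥ w)) ≈ φ m + a
      φ-shift = trans (shift a m j) (+-cong refl (trans (*-cong refl (proj₂ (proj₂ dual))) (*-identityʳ a)))
      to : φ (m +ᵥ (a ·ᵥ w)) ≈ a → φ m ≈ 0#
      to φ′≈a = +-cancelʳ a _ _ (trans (sym φ-shift) (trans φ′≈a (sym (+-identityˡ a))))
      from : φ m ≈ 0# → φ (m +ᵥ (a ·ᵥ w)) ≈ a
      from φ≈0 = trans φ-shift (trans (+-cong φ≈0 refl) (+-identityˡ a))

  count-orthogonal : ∀ js → Independent js → count (orthogonalᵇ js) (vecs elements k) ℕ.* q ℕ.^ length js ≡ q ℕ.^ k
  count-orthogonal []         _               = ≡.trans (ℕ.*-identityʳ _) (count-all k)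
  count-orthogonal (j ∷ js) ind@(_ , _ , ind′) = begin
    count (orthogonalᵇ (j ∷ js)) vs ℕ.* (q ℕ.* q ℕ.^ length js)  ≡⟨ ≡.sym (ℕ.*-assoc (count (orthogonalᵇ (j ∷ js)) vs) q _) ⟩
    count (orthogonalᵇ (j ∷ js)) vs ℕ.* q ℕ.* q ℕ.^ length js    ≡⟨ ≡.cong (ℕ._* q ℕ.^ length js) (ℕ.*-comm _ q) ⟩
    q ℕ.* count (orthogonalᵇ (j ∷ js)) vs ℕ.* q ℕ.^ length js    ≡⟨ ≡.cong (ℕ._* q ℕ.^ length js) (≡.sym (count-orthogonal-∷ j js ind)) ⟩
    count (orthogonalᵇ js) vs ℕ.* q ℕ.^ length js                ≡⟨ count-orthogonal js ind′ ⟩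
    q ℕ.^ k ∎
    where
    vs : List (Vec Carrier k)
    vs = vecs elements k

module Rank {c ℓ} (F : FiniteField c ℓ) {k n : ℕ} (G : Code.Matrix F k n)
            (ρ : Subset n → ℕ) (isRank : Code.IsRankFunction F G ρ) where
  open FiniteField F
  open FieldProperties field′
  open ColumnSpace F G
  open OrthogonalCount F G using (count-orthogonal)
  open Counting F using (count-cong; count-isZero; isZeroᵇ; q≥2)
  open Code F using (ColumnsIndependent; RowsIndependent; encode; supp)
  open import Data.Bool using (not)
  open import Data.Bool.Properties using (T-∧; T-≡)
  open import Data.Empty using (⊥-elim)
  open import Data.Fin.Subset using (_∈_; _∉_; _⊆_; _⊂_; _∪_; ⁅_⁆; ∁; ⊤; ∣_∣; inside; outside)
  open import Data.Fin.Subset.Properties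
    using (_∈?_; _⊆?_; x∈p∪q⁻; x∈p∪q⁺; p⊆p∪q; x∈⁅x⁆; x∈⁅y⁆⇒x≡y; p⊂q⇒∣p∣<∣q∣; p⊆q⇒∣p∣≤∣q∣; ∈⊤)
  open import Data.List.Membership.Propositional.Properties using (∈-filter⁻; ∈-filter⁺; ∈-allFin)
  open import Data.List.Relation.Unary.All.Properties using (All¬⇒¬Any)
  open import Data.List.Relation.Unary.AllPairs using (_∷_)
  import Data.List.Relation.Unary.Unique.Propositional as Propositional
  import Data.List.Relation.Unary.Unique.Propositional.Properties as Unique
  open import Data.Product using (_×_; _,_; proj₁; proj₂)
  open import Data.Vec as Vec using (lookup)
  import Data.Vec.Properties as Vec
  open import Data.Vec.Functional using (updateAt)
  open import Data.Vec.Functional.Properties using (updateAt-updates; updateAt-minimal)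
  open import Data.Unit using (tt)
  open import Function.Bundles using (mk⇔; module Equivalence)
  open import Relation.Nullary using (yes; no)
  open import Relation.Nullary.Decidable using (does-⇔; dec-true; dec-false)
  open import Relation.Binary.Definitions using (tri<; tri≈; tri>)
  open import Relation.Binary.Reasoning.Setoid setoid

  ∈-elementsOf⁻ : ∀ {I : Subset n} {t} → t ∈ₗ elementsOf I → t ∈ I
  ∈-elementsOf⁻ {I} t∈ = proj₂ (∈-filter⁻ (_∈? I) {xs = allFin n} t∈)

  ∈-elementsOf⁺ : ∀ {I : Subset n} {t} → t ∈ I → t ∈ₗ elementsOf I
  ∈-elementsOf⁺ {I} {t} t∈I = ∈-filter⁺ (_∈? I) (∈-allFin t) t∈I

  LinearlyIndependent : List (Fin n) → Set (c ⊔ ℓ)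
  LinearlyIndependent js =
    ∀ (a : Fin n → Carrier) → (∀ i → Σ js (λ j → a j * G i j) ≈ 0#) → ∀ t → t ∈ₗ js → a t ≈ 0#

  -- A dependency exhibiting a column as a combination of the later ones, or a relation among the later ones,
  -- extends (by the coefficient -1 resp. 0) to a relation on the whole list.
  linearlyIndependent⇒Independent : ∀ js → Propositional.Unique js → LinearlyIndependent js → Independent js
  linearlyIndependent⇒Independent []       _                li = lift tt
  linearlyIndependent⇒Independent (j ∷ js) (j≢js ∷ unique) li =
    j∉js , cⱼ∉span , linearlyIndependent⇒Independent js unique li-tail
    where
    j∉js : ¬ j ∈ₗ js
    j∉js = All¬⇒¬Any j≢js
    relation : ∀ (a : Fin n → Carrier) μ → (∀ i → μ * G i j + Σ js (λ t → a t * G i t) ≈ 0#) →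
               updateAt a j (λ _ → μ) j ≈ 0# × (∀ t → t ∈ₗ js → a t ≈ 0#)
    relation a μ rel =
      li a′ (λ i → trans (Σ-updateAt j js a μ (G i) j∉js) (rel i)) j (here ≡.refl) ,
      λ t t∈js → trans (reflexive (≡.sym (updateAt-minimal t j a (λ { ≡.refl → j∉js t∈js }))))
                       (li a′ (λ i → trans (Σ-updateAt j js a μ (G i) j∉js) (rel i)) t (there t∈js))
      where a′ = updateAt a j (λ _ → μ)
    cⱼ∉span : ¬ InSpan js (col j)
    cⱼ∉span (a , cⱼ≈Σ) = -1≉0 (trans (reflexive (≡.sym (updateAt-updates j a))) (proj₁ (relation a (- 1#) cancels)))
      where
      cancels : ∀ i → - 1# * G i j + Σ js (λ t → a t * G i t) ≈ 0#
      cancels i = trans (+-cong (-1*x≈-x _) (sym (cⱼ≈Σ i))) (-‿inverseˡ _)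
      -1≉0 : ¬ (- 1# ≈ 0#)
      -1≉0 -1≈0 = 0≉1 (sym (trans (sym (-‿involutive 1#)) (trans (-‿cong -1≈0) -0#≈0#)))
    li-tail : LinearlyIndependent js
    li-tail a rel = proj₂ (relation a 0# (λ i → trans (+-cong (zeroˡ _) (rel i)) (+-identityˡ _)))

  columnsIndependent⇒Independent : ∀ I → ColumnsIndependent G I → Independent (elementsOf I)
  columnsIndependent⇒Independent I ci =
    linearlyIndependent⇒Independent (elementsOf I) (Unique.filter⁺ (_∈? I) (Unique.allFin⁺ n))
      (λ a rel t t∈ → ci a rel t (∈-elementsOf⁻ t∈))

  Σ-elementsOf-∪⁅⁆ : ∀ I j → j ∉ I → ∀ (g : Fin n → Carrier) →
    Σ (elementsOf (I ∪ ⁅ j ⁆)) g ≈ g j + Σ (elementsOf I) g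
  Σ-elementsOf-∪⁅⁆ I j j∉I g = begin
    Σ (elementsOf (I ∪ ⁅ j ⁆)) g
      ≈⟨ Σ-filter (_∈? (I ∪ ⁅ j ⁆)) (allFin n) g ⟩
    Σ (allFin n) (λ t → when (does (t ∈? (I ∪ ⁅ j ⁆))) (g t))
      ≈⟨ Σ-cong (allFin n) split ⟩
    Σ (allFin n) (λ t → when (does (t Fin.≟ j)) (g t) + when (does (t ∈? I)) (g t))
      ≈⟨ Σ-+ (allFin n) _ _ ⟩
    Σ (allFin n) (λ t → when (does (t Fin.≟ j)) (g t)) + Σ (allFin n) (λ t → when (does (t ∈? I)) (g t))
      ≈⟨ +-cong (Σ-allFin-point j g) (sym (Σ-filter (_∈? I) (allFin n) g)) ⟩
    g j + Σ (elementsOf I) g ∎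
    where
    split : ∀ t → when (does (t ∈? (I ∪ ⁅ j ⁆))) (g t) ≈ when (does (t Fin.≟ j)) (g t) + when (does (t ∈? I)) (g t)
    split t with t Fin.≟ j
    ... | yes ≡.refl rewrite dec-true (t ∈? (I ∪ ⁅ t ⁆)) (x∈p∪q⁺ (inj₂ (x∈⁅x⁆ t))) | dec-false (t ∈? I) j∉I =
      sym (+-identityʳ _)
    ... | no t≢j rewrite does-⇔ (mk⇔ (λ t∈ → [ id , (λ t∈⁅j⁆ → ⊥-elim (t≢j (x∈⁅y⁆⇒x≡y j t∈⁅j⁆))) ]′ (x∈p∪q⁻ I ⁅ j ⁆ t∈))
                                     (p⊆p∪q ⁅ j ⁆))
                                (t ∈? (I ∪ ⁅ j ⁆)) (t ∈? I) =
      sym (+-identityˡ _)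

  Vanishes : Subset n → Vec Carrier k → Set ℓ
  Vanishes J m = ∀ j → j ∈ J → dot m (col j) ≈ 0#

  ColumnsIndependent-∪⁅⁆ : ∀ I j m → ColumnsIndependent G I → Vanishes I m → ¬ (dot m (col j) ≈ 0#) → j ∉ I →
                           ColumnsIndependent G (I ∪ ⁅ j ⁆)
  ColumnsIndependent-∪⁅⁆ I j m ci m⊥I m·cⱼ≉0 j∉I a rel t t∈ =
    [ ci a rest≈0 t , (λ t∈⁅j⁆ → ≡.subst (λ z → a z ≈ 0#) (≡.sym (x∈⁅y⁆⇒x≡y j t∈⁅j⁆)) aⱼ≈0) ]′ (x∈p∪q⁻ I ⁅ j ⁆ t∈)
    where
    rest : Fin k → Carrier
    rest i = Σ (elementsOf I) (λ t → a t * G i t)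
    rest+aⱼcⱼ≈0 : ∀ i → rest i + a j * G i j ≈ 0#
    rest+aⱼcⱼ≈0 i = trans (+-comm _ _) (trans (sym (Σ-elementsOf-∪⁅⁆ I j j∉I (λ t → a t * G i t))) (rel i))
    -- Apply the functional m, which kills the columns of I but not column j.
    aⱼ≈0 : a j ≈ 0#
    aⱼ≈0 = x≉0∧x*y≈0⇒y≈0 m·cⱼ≉0 (trans (*-comm _ _) (begin
      a j * dot m (col j)                                    ≈⟨ sym (+-identityˡ _) ⟩
      0# + a j * dot m (col j)                               ≈⟨ +-cong (sym (trans (dot-combination m (elementsOf I) a)
                                                                  (trans (Σ-cong-∈ (elementsOf I) (λ t t∈ → trans (*-cong refl (m⊥I t (∈-elementsOf⁻ t∈))) (zeroʳ _)))
                                                                         (Σ-zero (elementsOf I))))) refl ⟩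
      dot m rest + a j * dot m (col j)                       ≈⟨ sym (dot-linearʳ m rest (col j) (a j)) ⟩
      dot m (λ i → rest i + a j * G i j)                     ≈⟨ dot-zeroʳ m _ rest+aⱼcⱼ≈0 ⟩
      0#                                                     ∎))
    rest≈0 : ∀ i → rest i ≈ 0#
    rest≈0 i = trans (sym (+-identityʳ _)) (trans (+-cong refl (sym (trans (*-cong aⱼ≈0 refl) (zeroˡ _)))) (rest+aⱼcⱼ≈0 i))

  basis : Subset n → Subset n
  basis J = proj₁ (proj₁ (isRank J))

  basis⊆ : ∀ J → basis J ⊆ J
  basis⊆ J = proj₁ (proj₂ (proj₁ (isRank J)))

  basis-independent : ∀ J → ColumnsIndependent G (basis J)
  basis-independent J = proj₁ (proj₂ (proj₂ (proj₁ (isRank J))))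

  ∣basis∣≡ρ : ∀ J → ∣ basis J ∣ ≡ ρ J
  ∣basis∣≡ρ J = proj₂ (proj₂ (proj₂ (proj₁ (isRank J))))

  ρ-maximal : ∀ J I → I ⊆ J → ColumnsIndependent G I → ∣ I ∣ ≤ ρ J
  ρ-maximal J = proj₂ (isRank J)

  Vanishes-basis⇒Vanishes : ∀ J m → Vanishes (basis J) m → Vanishes J m
  Vanishes-basis⇒Vanishes J m m⊥B j j∈J with dot m (col j) ≟ 0#
  ... | yes m·cⱼ≈0 = m·cⱼ≈0
  ... | no m·cⱼ≉0 with j ∈? basis J
  ...   | yes j∈B = ⊥-elim (m·cⱼ≉0 (m⊥B j j∈B))
  ...   | no  j∉B = ⊥-elim (ℕ.<⇒≱ (p⊂q⇒∣p∣<∣q∣ B⊂B∪⁅j⁆) (≡.subst (∣ B ∪ ⁅ j ⁆ ∣ ≤_) (≡.sym (∣basis∣≡ρ J))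
                              (ρ-maximal J (B ∪ ⁅ j ⁆) B∪⁅j⁆⊆J (ColumnsIndependent-∪⁅⁆ B j m (basis-independent J) m⊥B m·cⱼ≉0 j∉B))))
    where
    B : Subset n
    B = basis J
    B⊂B∪⁅j⁆ : B ⊂ B ∪ ⁅ j ⁆
    B⊂B∪⁅j⁆ = (λ {t} → p⊆p∪q ⁅ j ⁆) , j , x∈p∪q⁺ (inj₂ (x∈⁅x⁆ j)) , j∉B
    B∪⁅j⁆⊆J : B ∪ ⁅ j ⁆ ⊆ J
    B∪⁅j⁆⊆J t∈ = [ basis⊆ J , (λ t∈⁅j⁆ → ≡.subst (_∈ J) (≡.sym (x∈⁅y⁆⇒x≡y j t∈⁅j⁆)) j∈J) ]′ (x∈p∪q⁻ B ⁅ j ⁆ t∈)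

  vanishesᵇ : Subset n → Vec Carrier k → Bool
  vanishesᵇ J m = J ⊆ᵇ ∁ (supp (encode G m))

  private
    lookup-∁-supp : ∀ (u : Fin n → Carrier) j → lookup (∁ (supp u)) j ≡ does (u j ≟ 0#)
    lookup-∁-supp u j =
      ≡.trans (Vec.lookup-map j not (supp u)) (≡.trans (≡.cong not (Vec.lookup∘tabulate _ j)) (not-if (does (u j ≟ 0#))))
      where
      not-if : ∀ b → not (if b then outside else inside) ≡ b
      not-if true  = ≡.refl
      not-if false = ≡.refl

    T⇒≡ : ∀ {a b} → (T a → T b) → (T b → T a) → a ≡ b
    T⇒≡ {true}  {true}  _ _ = ≡.refl
    T⇒≡ {false} {false} _ _ = ≡.refl
    T⇒≡ {true}  {false} f _ = ⊥-elim (f _)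
    T⇒≡ {false} {true}  _ g = ⊥-elim (g _)

  vanishesᵇ⇒Vanishes : ∀ J m → T (vanishesᵇ J m) → Vanishes J m
  vanishesᵇ⇒Vanishes J m _ j j∈J with J ⊆? ∁ (supp (encode G m))
  ... | yes J⊆zeros = T-≟0⇒≈0 (≡.subst T (≡.trans (≡.sym (Vec.[]=⇒lookup (J⊆zeros j∈J))) (lookup-∁-supp (encode G m) j)) _)

  Vanishes⇒vanishesᵇ : ∀ J m → Vanishes J m → T (vanishesᵇ J m)
  Vanishes⇒vanishesᵇ J m m⊥J with J ⊆? ∁ (supp (encode G m))
  ... | yes _        = _
  ... | no  J⊈zeros = J⊈zeros (λ {j} j∈J → Vec.lookup⇒[]= j _
                        (≡.trans (lookup-∁-supp (encode G m) j) (T-≡ .Equivalence.to (≈0⇒T-≟0 (m⊥J j j∈J)))))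

  vanishesᵇ≡orthogonalᵇ-basis : ∀ J m → vanishesᵇ J m ≡ orthogonalᵇ (elementsOf (basis J)) m
  vanishesᵇ≡orthogonalᵇ-basis J m = T⇒≡
    (λ t → Orthogonal⇒orthogonalᵇ _ m (λ s s∈ → vanishesᵇ⇒Vanishes J m t s (basis⊆ J (∈-elementsOf⁻ s∈))))
    (λ t → Vanishes⇒vanishesᵇ J m (Vanishes-basis⇒Vanishes J m (λ s s∈B →
             orthogonalᵇ⇒Orthogonal _ m t s (∈-elementsOf⁺ s∈B))))

  count-vanishing : ∀ J → count (vanishesᵇ J) (vecs elements k) ℕ.* q ℕ.^ ρ J ≡ q ℕ.^ k
  count-vanishing J = ≡.trans
    (≡.cong₂ ℕ._*_ (count-cong (vecs elements k) (vanishesᵇ≡orthogonalᵇ-basis J))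
                   (≡.cong (q ℕ.^_) (≡.sym (≡.trans (length-elementsOf (basis J)) (∣basis∣≡ρ J)))))
    (count-orthogonal (elementsOf (basis J)) (columnsIndependent⇒Independent (basis J) (basis-independent J)))

  ρ≤ρ⊤ : ∀ J → ρ J ≤ ρ ⊤
  ρ≤ρ⊤ J = ≡.subst (_≤ ρ ⊤) (∣basis∣≡ρ J) (ρ-maximal ⊤ (basis J) (λ {x} _ → ∈⊤) (basis-independent J))

  ρ≤∣∣ : ∀ J → ρ J ≤ ∣ J ∣
  ρ≤∣∣ J = ≡.subst (_≤ ∣ J ∣) (∣basis∣≡ρ J) (p⊆q⇒∣p∣≤∣q∣ (basis⊆ J))

  -- With independent rows, only the zero message vanishes everywhere, so q ^ ρ ⊤ = q ^ k.
  ρ⊤≡k : RowsIndependent G → ρ ⊤ ≡ k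
  ρ⊤≡k rows-independent = ^-injectiveʳ (≡.trans (≡.sym (ℕ.*-identityˡ _))
    (≡.trans (≡.cong (ℕ._* q ℕ.^ ρ ⊤) (≡.sym (≡.trans (count-cong (vecs elements k) vanishes⊤≡isZero) (count-isZero k))))
             (count-vanishing ⊤)))
    where
    ^-injectiveʳ : ∀ {a b} → q ℕ.^ a ≡ q ℕ.^ b → a ≡ b
    ^-injectiveʳ {a} {b} qᵃ≡qᵇ with ℕ.<-cmp a b
    ... | tri< a<b _ _ = ⊥-elim (ℕ.<-irrefl qᵃ≡qᵇ (ℕ.^-monoʳ-< q q≥2 a<b))
    ... | tri≈ _ a≡b _ = a≡b
    ... | tri> _ _ b<a = ⊥-elim (ℕ.<-irrefl (≡.sym qᵃ≡qᵇ) (ℕ.^-monoʳ-< q q≥2 b<a))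
    isZero⇒≈0 : ∀ {k′} (m : Vec Carrier k′) → T (isZeroᵇ m) → ∀ i → lookup m i ≈ 0#
    isZero⇒≈0 (a ∷ m) t Fin.zero    = T-≟0⇒≈0 (proj₁ (T-∧ .Equivalence.to t))
    isZero⇒≈0 (a ∷ m) t (Fin.suc i) = isZero⇒≈0 m (proj₂ (T-∧ .Equivalence.to t)) i
    ≈0⇒isZero : ∀ {k′} (m : Vec Carrier k′) → (∀ i → lookup m i ≈ 0#) → T (isZeroᵇ m)
    ≈0⇒isZero []      _   = _
    ≈0⇒isZero (a ∷ m) m≈0 = T-∧ .Equivalence.from (≈0⇒T-≟0 (m≈0 Fin.zero) , ≈0⇒isZero m (m≈0 ∘ Fin.suc))
    vanishes⊤≡isZero : ∀ m → vanishesᵇ ⊤ m ≡ isZeroᵇ m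
    vanishes⊤≡isZero m = T⇒≡
      (λ t → ≈0⇒isZero m (rows-independent (lookup m) (λ j → vanishesᵇ⇒Vanishes ⊤ m t j ∈⊤)))
      (λ t → Vanishes⇒vanishesᵇ ⊤ m (λ j _ → dot-zeroˡ m (col j) (isZero⇒≈0 m t)))

  ρ≤k : RowsIndependent G → ∀ J → ρ J ≤ k
  ρ≤k rows-independent J = ≡.subst (ρ J ≤_) (ρ⊤≡k rows-independent) (ρ≤ρ⊤ J)

  count-vanishing-exact : RowsIndependent G → ∀ J → count (vanishesᵇ J) (vecs elements k) ≡ q ℕ.^ (k ∸ ρ J)
  count-vanishing-exact rows-independent J =
    ℕ.*-cancelʳ-≡ _ _ (q ℕ.^ ρ J) {{ℕ.m^n≢0 q (ρ J) {{ℕ.>-nonZero (ℕ.≤-trans (ℕ.s≤s ℕ.z≤n) q≥2)}}}}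
      (≡.trans (count-vanishing J)
               (≡.trans (≡.cong (q ℕ.^_) (≡.sym (ℕ.m∸n+n≡m (ρ≤k rows-independent J))))
                        (ℕ.^-distribˡ-+-* q (k ∸ ρ J) (ρ J))))

module WeightEnumerator {c ℓ c′ ℓ′} (K : Field c ℓ) (F : FiniteField c′ ℓ′) {k n : ℕ} (G : Code.Matrix F k n) where
  open Field K
  open FieldProperties K
  open Harmonic K using (tilde; tutte; IsHarmonic; A; Zpoly)
  open Code F using (codewords; encode; supp; wt; RowsIndependent; IsRankFunction)
  open HarmonicComplement K using (tilde-∁)
  open import Data.Fin.Subset using (∣_∣; ∁; inside)
  open import Data.Vec as Vec using (tabulate)
  import Data.Vec.Properties as Vec
  open import Data.Fin.Subset.Properties using (∣p∣≤n; ∣∁p∣≡n∸∣p∣)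
  open import Data.List using (upTo)
  open import Data.List.Membership.Propositional.Properties using (∈-upTo⁺)
  import Data.List.Relation.Unary.Unique.Propositional.Properties as Unique
  open import Relation.Binary.Reasoning.Setoid setoid

  Zpoly≈Σ-codewords : ∀ d f x y (x≉0 : ¬ (x ≈ 0#)) (y≉0 : ¬ (y ≈ 0#)) →
    Zpoly F G d f x y x≉0 y≉0 ≈
    Σ (codewords G) (λ u → tilde d f (supp u) * Laurent.monomial x x≉0 n (wt u ℕ.+ d) * Laurent.monomial y y≉0 (wt u) d)
  Zpoly≈Σ-codewords d f x y x≉0 y≉0 = begin
    Σ (upTo (suc n)) (λ i → A F G d f i * powℤ x x≉0 (+ n ℤ.- + i ℤ.- + d) * powℤ y y≉0 (+ i ℤ.- + d))
      ≈⟨ Σ-cong (upTo (suc n)) by-weight ⟩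
    Σ (upTo (suc n)) (λ i → Σ (codewords G) (λ u → when (wt u ℕ.≡ᵇ i) (term u i)))
      ≈⟨ Σ-swap (upTo (suc n)) (codewords G) _ ⟩
    Σ (codewords G) (λ u → Σ (upTo (suc n)) (λ i → when (wt u ℕ.≡ᵇ i) (term u i)))
      ≈⟨ Σ-cong (codewords G) (λ u → Σ-unique-point (upTo (suc n)) (wt u) (term u) (∈-upTo⁺ (ℕ.s≤s (∣p∣≤n (supp u))))
                                                     (Unique.upTo⁺ (suc n))) ⟩
    Σ (codewords G) (λ u → term u (wt u)) ∎
    where
    term : (Fin n → FiniteField.Carrier F) → ℕ → Carrier
    term u i = tilde d f (supp u) * Laurent.monomial x x≉0 n (i ℕ.+ d) * Laurent.monomial y y≉0 i d
    by-weight : ∀ i → A F G d f i * powℤ x x≉0 (+ n ℤ.- + i ℤ.- + d) * powℤ y y≉0 (+ i ℤ.- + d) ≈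
                      Σ (codewords G) (λ u → when (wt u ℕ.≡ᵇ i) (term u i))
    by-weight i = begin
      A F G d f i * powℤ x x≉0 (+ n ℤ.- + i ℤ.- + d) * powℤ y y≉0 (+ i ℤ.- + d)
        ≈⟨ *-cong (*-cong (Σ-filter (λ u → wt u ℕ.≟ i) (codewords G) _) (Laurent.powℤ≈monomial₃ x x≉0 n i d))
                  (Laurent.powℤ≈monomial y y≉0 i d) ⟩
      Σ (codewords G) (λ u → when (wt u ℕ.≡ᵇ i) (tilde d f (supp u))) * mx * my
        ≈⟨ trans (*-cong (*-distribʳ-Σ (codewords G) mx _) refl) (*-distribʳ-Σ (codewords G) my _) ⟩
      Σ (codewords G) (λ u → when (wt u ℕ.≡ᵇ i) (tilde d f (supp u)) * mx * my)
        ≈⟨ Σ-cong (codewords G) (λ u → trans (*-cong (when-*ʳ _ _ _) refl) (when-*ʳ _ _ _)) ⟩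
      Σ (codewords G) (λ u → when (wt u ℕ.≡ᵇ i) (term u i)) ∎
      where
      mx : Carrier
      mx = Laurent.monomial x x≉0 n (i ℕ.+ d)
      my : Carrier
      my = Laurent.monomial y y≉0 i d

  Σ-codewords-⊆zeros : RowsIndependent G → ∀ ρ → IsRankFunction G ρ → ∀ (g : Subset n → Carrier) →
    Σ (codewords G) (λ u → Σ (allSubsets n) (λ J → when (J ⊆ᵇ ∁ (supp u)) (g J))) ≈
    Σ (allSubsets n) (λ J → ℕ→ (FiniteField.q F ℕ.^ (k ∸ ρ J)) * g J)
  Σ-codewords-⊆zeros rows-independent ρ isRank g = begin
    Σ (codewords G) (λ u → Σ (allSubsets n) (λ J → when (J ⊆ᵇ ∁ (supp u)) (g J)))
      ≈⟨ Σ-map (encode G) (vecs (FiniteField.elements F) k) _ ⟩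
    Σ (vecs (FiniteField.elements F) k) (λ m → Σ (allSubsets n) (λ J → when (vanishesᵇ J m) (g J)))
      ≈⟨ Σ-swap (vecs (FiniteField.elements F) k) (allSubsets n) _ ⟩
    Σ (allSubsets n) (λ J → Σ (vecs (FiniteField.elements F) k) (λ m → when (vanishesᵇ J m) (g J)))
      ≈⟨ Σ-cong (allSubsets n) (λ J → trans (Σ-when≈count (vecs (FiniteField.elements F) k) (vanishesᵇ J) (g J))
                                            (*-cong (reflexive (≡.cong ℕ→ (count-vanishing-exact rows-independent J))) refl)) ⟩
    Σ (allSubsets n) (λ J → ℕ→ (FiniteField.q F ℕ.^ (k ∸ ρ J)) * g J) ∎
    where open Rank F G ρ isRank using (vanishesᵇ; count-vanishing-exact)

  module AtPoint (x y : Carrier) (x≉0 : ¬ (x ≈ 0#)) (y≉0 : ¬ (y ≈ 0#)) (x−y≉0 : ¬ ((x − y) ≈ 0#)) where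
    open Laurent x x≉0 using () renaming (monomial to x^)
    open Laurent y y≉0 using () renaming (monomial to y^)
    open Laurent (x − y) x−y≉0 using () renaming (monomial to [x−y]^)
    open BinomialExpansion.Weights K x y x≉0 y≉0 x−y≉0 using (weight; coweight; Σ-⊆-tilde*weight)
    private
      q : ℕ
      q = FiniteField.q F
      y⁻¹ : Carrier
      y⁻¹ = inv y y≉0
      [x−y]⁻¹ : Carrier
      [x−y]⁻¹ = inv (x − y) x−y≉0

    tilde-expansion : CharZero K → ∀ d f → IsHarmonic d f → ∀ S →
      tilde d f S * x^ n (∣ S ∣ ℕ.+ d) * y^ ∣ S ∣ d ≈
      pow (- 1#) d * Σ (allSubsets n) (λ J → when (J ⊆ᵇ ∁ S) (tilde d f J * weight d J))
    tilde-expansion char0 d f harmonic S = begin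
      tilde d f S * x^ n (w ℕ.+ d) * y^ w d
        ≈⟨ *-cong (*-cong (tilde-∁ char0 d f harmonic S) (Laurent.monomial-≡ x x≉0 n (w ℕ.+ d) ∣ ∁ S ∣ d x-exponents))
                  (Laurent.monomial-≡ y y≉0 w d n (∣ ∁ S ∣ ℕ.+ d) y-exponents) ⟩
      (pow (- 1#) d * tilde d f (∁ S)) * x^ ∣ ∁ S ∣ d * y^ n (∣ ∁ S ∣ ℕ.+ d)
        ≈⟨ trans (*-assoc _ _ _) (*-assoc _ _ _) ⟩
      pow (- 1#) d * (tilde d f (∁ S) * coweight d (∁ S))
        ≈⟨ *-cong refl (sym (Σ-⊆-tilde*weight d f (∁ S))) ⟩
      pow (- 1#) d * Σ (allSubsets n) (λ J → when (J ⊆ᵇ ∁ S) (tilde d f J * weight d J)) ∎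
      where
      w : ℕ
      w = ∣ S ∣
      ∣∁S∣+w≡n : ∣ ∁ S ∣ ℕ.+ w ≡ n
      ∣∁S∣+w≡n = ≡.trans (≡.cong (ℕ._+ w) (∣∁p∣≡n∸∣p∣ S)) (ℕ.m∸n+n≡m (∣p∣≤n S))
      x-exponents : n ℕ.+ d ≡ ∣ ∁ S ∣ ℕ.+ (w ℕ.+ d)
      x-exponents = ≡.trans (≡.cong (ℕ._+ d) (≡.sym ∣∁S∣+w≡n)) (ℕ.+-assoc ∣ ∁ S ∣ w d)
      y-exponents : w ℕ.+ (∣ ∁ S ∣ ℕ.+ d) ≡ n ℕ.+ d
      y-exponents = ≡.trans (≡.sym (ℕ.+-assoc w ∣ ∁ S ∣ d))
                            (≡.cong (ℕ._+ d) (≡.trans (ℕ.+-comm w ∣ ∁ S ∣) ∣∁S∣+w≡n))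

    X Y : Carrier
    X = (x + ℕ→ (q ∸ 1) * y) * [x−y]⁻¹
    Y = x * y⁻¹

    X−1≈ : X − 1# ≈ (ℕ→ q * y) * [x−y]⁻¹
    X−1≈ = begin
      (x + q−1 * y) * [x−y]⁻¹ + - 1#                     ≈⟨ +-cong refl (trans (-‿cong (sym (inv-law (x − y) x−y≉0)))
                                                                              (-‿distribˡ-* _ _)) ⟩
      (x + q−1 * y) * [x−y]⁻¹ + (- (x − y)) * [x−y]⁻¹    ≈⟨ sym (distribʳ _ _ _) ⟩
      ((x + q−1 * y) + - (x − y)) * [x−y]⁻¹              ≈⟨ *-cong numerator refl ⟩
      (ℕ→ q * y) * [x−y]⁻¹                                 ∎
      where
      q−1 : Carrier
      q−1 = ℕ→ (q ∸ 1)
      numerator : (x + q−1 * y) + - (x − y) ≈ ℕ→ q * y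
      numerator = begin
        (x + q−1 * y) + - (x + - y)    ≈⟨ +-cong refl (trans (sym (-‿+-comm x (- y))) (+-cong refl (-‿involutive y))) ⟩
        (x + q−1 * y) + (- x + y)      ≈⟨ +-interchange _ _ _ _ ⟩
        (x + - x) + (q−1 * y + y)      ≈⟨ trans (+-cong (-‿inverseʳ x) refl) (+-identityˡ _) ⟩
        q−1 * y + y                    ≈⟨ trans (+-comm _ _) (+-cong (sym (*-identityˡ y)) refl) ⟩
        1# * y + q−1 * y               ≈⟨ sym (distribʳ y 1# q−1) ⟩
        ℕ→ (suc (q ∸ 1)) * y         ≡⟨ ≡.cong (λ m → ℕ→ m * y) (ℕ.suc-pred q {{ℕ.>-nonZero (ℕ.≤-trans (ℕ.s≤s ℕ.z≤n) (Counting.q≥2 F))}}) ⟩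
        ℕ→ q * y                     ∎

    Y−1≈ : Y − 1# ≈ (x − y) * y⁻¹
    Y−1≈ = begin
      x * y⁻¹ + - 1#             ≈⟨ +-cong refl (trans (-‿cong (sym (inv-law y y≉0))) (-‿distribˡ-* _ _)) ⟩
      x * y⁻¹ + (- y) * y⁻¹      ≈⟨ sym (distribʳ y⁻¹ x (- y)) ⟩
      (x − y) * y⁻¹              ∎

    tutte-factor : ∀ d {r j} → r ≤ k → r ≤ j →
      ([x−y]^ k d * y^ n (k ℕ.+ d)) * (pow (X − 1#) (k ∸ r) * pow (Y − 1#) (j ∸ r)) ≈
      ℕ→ (q ℕ.^ (k ∸ r)) * ([x−y]^ j d * y^ n (j ℕ.+ d))
    tutte-factor d {r} {j} r≤k r≤j = begin
      ([x−y]^ k d * y^ n (k ℕ.+ d)) * (pow (X − 1#) e * pow (Y − 1#) g)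
        ≈⟨ *-cong refl (*-cong X-part Y-part) ⟩
      ([x−y]^ k d * y^ n (k ℕ.+ d)) * (((ℕ→ (q ℕ.^ e) * y^ e 0) * [x−y]^ 0 e) * ([x−y]^ g 0 * y^ 0 g))
        ≈⟨ solve 7 (λ a₁ b₁ c b₂ a₂ a₃ b₃ → (a₁ ⊗ b₁) ⊗ (((c ⊗ b₂) ⊗ a₂) ⊗ (a₃ ⊗ b₃)) ⊜
                                            c ⊗ (((a₁ ⊗ a₂) ⊗ a₃) ⊗ ((b₁ ⊗ b₂) ⊗ b₃))) refl
                   ([x−y]^ k d) (y^ n (k ℕ.+ d)) (ℕ→ (q ℕ.^ e)) (y^ e 0) ([x−y]^ 0 e) ([x−y]^ g 0) (y^ 0 g) ⟩
      ℕ→ (q ℕ.^ e) * ((([x−y]^ k d * [x−y]^ 0 e) * [x−y]^ g 0) * ((y^ n (k ℕ.+ d) * y^ e 0) * y^ 0 g))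
        ≈⟨ *-cong refl (*-cong [x−y]-part y-part) ⟩
      ℕ→ (q ℕ.^ (k ∸ r)) * ([x−y]^ j d * y^ n (j ℕ.+ d)) ∎
      where
      e : ℕ
      e = k ∸ r
      g : ℕ
      g = j ∸ r
      k+g≡j+e : k ℕ.+ g ≡ j ℕ.+ e
      k+g≡j+e = ≡.trans (≡.sym (ℕ.+-∸-assoc k r≤j)) (≡.trans (≡.cong (_∸ r) (ℕ.+-comm k j)) (ℕ.+-∸-assoc j r≤k))
      X-part : pow (X − 1#) e ≈ (ℕ→ (q ℕ.^ e) * y^ e 0) * [x−y]^ 0 e
      X-part = begin
        pow (X − 1#) e                                   ≈⟨ pow-cong e X−1≈ ⟩
        pow ((ℕ→ q * y) * [x−y]⁻¹) e                     ≈⟨ trans (pow-* _ _ e) (*-cong (pow-* _ _ e) refl) ⟩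
        (pow (ℕ→ q) e * pow y e) * pow [x−y]⁻¹ e         ≈⟨ *-cong (*-cong (sym (ℕ→-^ q e)) (Laurent.pow≈monomial y y≉0 e))
                                                                   (Laurent.pow-x⁻¹≈monomial (x − y) x−y≉0 e) ⟩
        (ℕ→ (q ℕ.^ e) * y^ e 0) * [x−y]^ 0 e             ∎
      Y-part : pow (Y − 1#) g ≈ [x−y]^ g 0 * y^ 0 g
      Y-part = trans (pow-cong g Y−1≈) (trans (pow-* _ _ g)
                 (*-cong (Laurent.pow≈monomial (x − y) x−y≉0 g) (Laurent.pow-x⁻¹≈monomial y y≉0 g)))
      [x−y]-part : ([x−y]^ k d * [x−y]^ 0 e) * [x−y]^ g 0 ≈ [x−y]^ j d
      [x−y]-part = trans (*-cong (Laurent.monomial-* (x − y) x−y≉0 k d 0 e) refl)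
                   (trans (Laurent.monomial-* (x − y) x−y≉0 (k ℕ.+ 0) (d ℕ.+ e) g 0)
                          (Laurent.monomial-≡ (x − y) x−y≉0 (k ℕ.+ 0 ℕ.+ g) (d ℕ.+ e ℕ.+ 0) j d
                            (≡.trans (lhs k g d) (≡.trans (≡.cong (ℕ._+ d) k+g≡j+e) (rhs j e d)))))
        where
        lhs : ∀ k g d → k ℕ.+ 0 ℕ.+ g ℕ.+ d ≡ k ℕ.+ g ℕ.+ d
        lhs = ℕ-Solver.solve-∀
        rhs : ∀ j e d → j ℕ.+ e ℕ.+ d ≡ j ℕ.+ (d ℕ.+ e ℕ.+ 0)
        rhs = ℕ-Solver.solve-∀
      y-part : (y^ n (k ℕ.+ d) * y^ e 0) * y^ 0 g ≈ y^ n (j ℕ.+ d)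
      y-part = trans (*-cong (Laurent.monomial-* y y≉0 n (k ℕ.+ d) e 0) refl)
               (trans (Laurent.monomial-* y y≉0 (n ℕ.+ e) (k ℕ.+ d ℕ.+ 0) 0 g)
                      (Laurent.monomial-≡ y y≉0 (n ℕ.+ e ℕ.+ 0) (k ℕ.+ d ℕ.+ 0 ℕ.+ g) n (j ℕ.+ d)
                        (≡.trans (lhs n e j d) (≡.trans (≡.cong (λ m → n ℕ.+ (m ℕ.+ d)) (≡.sym k+g≡j+e)) (rhs n k g d)))))
        where
        lhs : ∀ n e j d → n ℕ.+ e ℕ.+ 0 ℕ.+ (j ℕ.+ d) ≡ n ℕ.+ (j ℕ.+ e ℕ.+ d)
        lhs = ℕ-Solver.solve-∀
        rhs : ∀ n k g d → n ℕ.+ (k ℕ.+ g ℕ.+ d) ≡ n ℕ.+ (k ℕ.+ d ℕ.+ 0 ℕ.+ g)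
        rhs = ℕ-Solver.solve-∀

    tutte-expansion : RowsIndependent G → ∀ ρ → IsRankFunction G ρ → ∀ d f →
      pow (- 1#) d * Σ (allSubsets n) (λ J → ℕ→ (q ℕ.^ (k ∸ ρ J)) * (tilde d f J * weight d J)) ≈
      ((pow (- 1#) d * powℤ (x − y) x−y≉0 (+ k ℤ.- + d)) * powℤ y y≉0 (+ n ℤ.- + k ℤ.- + d)) * tutte ρ d f X Y
    tutte-expansion rows-independent ρ isRank d f = begin
      pow (- 1#) d * Σ (allSubsets n) (λ J → ℕ→ (q ℕ.^ (k ∸ ρ J)) * (tilde d f J * weight d J))
        ≈⟨ *-cong refl (Σ-cong (allSubsets n) (λ J → sym (summand J))) ⟩
      pow (- 1#) d * Σ (allSubsets n) (λ J → P * tutte-summand J)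
        ≈⟨ *-cong refl (sym (*-distribˡ-Σ (allSubsets n) P tutte-summand)) ⟩
      pow (- 1#) d * (P * tutte ρ d f X Y)
        ≈⟨ trans (sym (*-assoc _ _ _)) (*-cong (sym (*-assoc _ _ _)) refl) ⟩
      ((pow (- 1#) d * [x−y]^ k d) * y^ n (k ℕ.+ d)) * tutte ρ d f X Y
        ≈⟨ *-cong (*-cong (*-cong refl (sym (Laurent.powℤ≈monomial (x − y) x−y≉0 k d)))
                          (sym (Laurent.powℤ≈monomial₃ y y≉0 n k d))) refl ⟩
      ((pow (- 1#) d * powℤ (x − y) x−y≉0 (+ k ℤ.- + d)) * powℤ y y≉0 (+ n ℤ.- + k ℤ.- + d)) * tutte ρ d f X Y ∎
      where
      open Rank F G ρ isRank using (ρ⊤≡k; ρ≤k; ρ≤∣∣)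
      P : Carrier
      P = [x−y]^ k d * y^ n (k ℕ.+ d)
      tutte-summand : Subset n → Carrier
      tutte-summand J = tilde d f J * pow (X − 1#) (ρ (tabulate (λ _ → inside)) ∸ ρ J) * pow (Y − 1#) (∣ J ∣ ∸ ρ J)
      ρE≡k : ρ (tabulate (λ _ → inside)) ≡ k
      ρE≡k = ≡.trans (≡.cong ρ (≡.trans (Vec.tabulate-allFin _) (Vec.map-const (Vec.allFin n) inside))) (ρ⊤≡k rows-independent)
      summand : ∀ J → P * tutte-summand J ≈ ℕ→ (q ℕ.^ (k ∸ ρ J)) * (tilde d f J * weight d J)
      summand J rewrite ρE≡k = begin
        P * (tilde d f J * pow (X − 1#) (k ∸ ρ J) * pow (Y − 1#) (∣ J ∣ ∸ ρ J))
          ≈⟨ solve 4 (λ p t a b → p ⊗ ((t ⊗ a) ⊗ b) ⊜ t ⊗ (p ⊗ (a ⊗ b))) refl P (tilde d f J) _ _ ⟩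
        tilde d f J * (P * (pow (X − 1#) (k ∸ ρ J) * pow (Y − 1#) (∣ J ∣ ∸ ρ J)))
          ≈⟨ *-cong refl (tutte-factor d (ρ≤k rows-independent J) (ρ≤∣∣ J)) ⟩
        tilde d f J * (ℕ→ (q ℕ.^ (k ∸ ρ J)) * weight d J)
          ≈⟨ *-left-comm _ _ _ ⟩
        ℕ→ (q ℕ.^ (k ∸ ρ J)) * (tilde d f J * weight d J) ∎

theorem4p4 : ∀ {c ℓ c′ ℓ′} (K : Field c ℓ) → CharZero K → (F : FiniteField c′ ℓ′) →
  (n k : ℕ) (G : Code.Matrix F k n) → Code.RowsIndependent F G →
  (ρ : Subset n → ℕ) → Code.IsRankFunction F G ρ →
  (d : ℕ) (f : Subset n → Field.Carrier K) → Harmonic.IsHarmonic K d f →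
  (x y : Field.Carrier K) (hx : ¬ Field._≈_ K x (Field.0# K)) (hy : ¬ Field._≈_ K y (Field.0# K))
  (hxy : ¬ Field._≈_ K (Field._−_ K x y) (Field.0# K)) →
  Field._≈_ K (Harmonic.Zpoly K F G d f x y hx hy)
    (Field._*_ K
      (Field._*_ K
        (Field._*_ K (Field.pow K (Field.-_ K (Field.1# K)) d)
          (Field.powℤ K (Field._−_ K x y) hxy ((+ k) - (+ d))))
        (Field.powℤ K y hy ((+ n) - (+ k) - (+ d))))
      (Harmonic.tutte K ρ d f
        (Field._*_ K
          (Field._+_ K x (Field._*_ K (Field.ℕ→ K (FiniteField.q F ∸ 1)) y))
          (Field.inv K (Field._−_ K x y) hxy))
        (Field._*_ K x (Field.inv K y hy))))
theorem4p4 K char0 F n k G rows-independent ρ isRank d f harmonic x y x≉0 y≉0 x−y≉0 = begin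
  Zpoly F G d f x y x≉0 y≉0
    ≈⟨ Zpoly≈Σ-codewords d f x y x≉0 y≉0 ⟩
  Σ (codewords G) (λ u → tilde d f (supp u) * x^ n (wt u ℕ.+ d) * y^ (wt u) d)
    ≈⟨ Σ-cong (codewords G) (λ u → tilde-expansion char0 d f harmonic (supp u)) ⟩
  Σ (codewords G) (λ u → sign * Σ (allSubsets n) (λ J → when (J ⊆ᵇ ∁ (supp u)) (term J)))
    ≈⟨ sym (*-distribˡ-Σ (codewords G) sign _) ⟩
  sign * Σ (codewords G) (λ u → Σ (allSubsets n) (λ J → when (J ⊆ᵇ ∁ (supp u)) (term J)))
    ≈⟨ *-cong refl (Σ-codewords-⊆zeros rows-independent ρ isRank term) ⟩
  sign * Σ (allSubsets n) (λ J → ℕ→ (FiniteField.q F ℕ.^ (k ∸ ρ J)) * term J)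
    ≈⟨ tutte-expansion rows-independent ρ isRank d f ⟩
  ((sign * powℤ (x − y) x−y≉0 (+ k ℤ.- + d)) * powℤ y y≉0 (+ n ℤ.- + k ℤ.- + d)) * tutte ρ d f X Y ∎
  where
  open Field K
  open FieldProperties K using (Σ; Σ-cong; *-distribˡ-Σ; when; module Laurent)
  open Harmonic K using (tilde; tutte; Zpoly)
  open Code F using (codewords; supp; wt)
  open WeightEnumerator K F G
  open AtPoint x y x≉0 y≉0 x−y≉0
  open BinomialExpansion.Weights K x y x≉0 y≉0 x−y≉0 using (weight)
  open Laurent x x≉0 using () renaming (monomial to x^)
  open Laurent y y≉0 using () renaming (monomial to y^)
  open import Data.Fin.Subset using (∁)
  open import Relation.Binary.Reasoning.Setoid setoid
  sign : Carrier
  sign = pow (- 1#) d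
  term : Subset n → Carrier
  term J = tilde d f J * weight d J
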